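{- The class of quasi-diamond-free graphs has bounded clique-width.
   Context: All graphs are finite, simple and undirected. $G$ is $H$-free if it has no induced subgraph isomorphic to $H$. A graph is chordal if it contains no induced cycle $C_r$ with $r\geq 4$. The diamond $\overline{2P_1+P_2}$ is $K_4$ minus one edge. A graph $G=(V,E)$ is quasi-diamond-free if $V$ can be partitioned into a clique $V_1$ and a (possibly empty) set $V_2=V\setminus V_1$ such that $G[V_2]$ is a diamond-free chordal graph and every connected component of $G[V_2]$ has at most one neighbour in $V_1$ (i.e. at most one vertex of $V_1$ is adjacent to some vertex of the component). The clique-width of a graph $G$ is the minimum number $k$ of labels needed to construct $G$ using the operations: create a single vertex with label $i$; take the disjoint union of two labelled graphs; add all edges between vertices of label $i$ and vertices of label $j$ ($i\neq j$); rename label $i$ to $j$. A class of graphs has bounded clique-width if there is a constant $c$ such that every graph in the class has clique-width at most $c$. -}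

module Defs where

open import Data.Nat using (ℕ; zero; suc; _+_; _%_; _≡ᵇ_)
open import Data.Fin using (Fin; zero; suc; toℕ; _≟_; splitAt)
open import Data.Bool using (Bool; true; false; _∧_; _∨_; not; T; if_then_else_)
open import Data.Sum using (_⊎_; inj₁; inj₂; [_,_])
open import Data.Product using (Σ; _×_; ∃)
open import Relation.Binary.PropositionalEquality using (_≡_; _≢_)
open import Relation.Nullary using (¬_)
open import Relation.Nullary.Decidable using (⌊_⌋)
open import Function.Definitions using (Injective)
open import Function.Bundles using (_↔_; Inverse)

record Graph (n : ℕ) : Set where
  field
    adj    : Fin n → Fin n → Bool
    sym    : ∀ u v → adj u v ≡ adj v u
    irrefl : ∀ v → adj v v ≡ false

open Graph public

Pattern : ℕ → Set
Pattern h = Fin h → Fin h → Bool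

InducedIn : ∀ {n} (S : Fin n → Bool) (G : Graph n) {h : ℕ} (A : Pattern h) → Set
InducedIn {n} S G {h} A =
  Σ (Fin h → Fin n) λ f →
    Injective _≡_ _≡_ f
    × (∀ a → S (f a) ≡ true)
    × (∀ a b → A a b ≡ adj G (f a) (f b))

FreeOn : ∀ {n} (S : Fin n → Bool) (G : Graph n) {h : ℕ} (A : Pattern h) → Set
FreeOn S G A = ¬ InducedIn S G A

cycleAdj : (m : ℕ) → Pattern (4 + m)
cycleAdj m a b =
  (((toℕ a + 1) % (4 + m)) ≡ᵇ toℕ b) ∨ (((toℕ b + 1) % (4 + m)) ≡ᵇ toℕ a)

-- The diamond K_4 minus the edge {0,3}
isEnd : Fin 4 → Bool
isEnd zero = true
isEnd (suc (suc (suc zero))) = true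
isEnd _ = false

diamondAdj : Pattern 4
diamondAdj a b = not ⌊ a ≟ b ⌋ ∧ not (isEnd a ∧ isEnd b)

ChordalOn : ∀ {n} (S : Fin n → Bool) (G : Graph n) → Set
ChordalOn S G = ∀ (m : ℕ) → FreeOn S G (cycleAdj m)

data ConnOn {n} (S : Fin n → Bool) (G : Graph n) (u : Fin n) : Fin n → Set where
  here : S u ≡ true → ConnOn S G u u
  step : ∀ {v w} → ConnOn S G u v → S w ≡ true → adj G v w ≡ true → ConnOn S G u w

complement : ∀ {n} → (Fin n → Bool) → (Fin n → Bool)
complement S v = not (S v)

QuasiDiamondFree : ∀ {n} → Graph n → Set
QuasiDiamondFree {n} G =
  Σ (Fin n → Bool) λ V1 →
    (∀ u v → V1 u ≡ true → V1 v ≡ true → u ≢ v → adj G u v ≡ true)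
    × FreeOn (complement V1) G diamondAdj
    × ChordalOn (complement V1) G
    × (∀ u v x y → ConnOn (complement V1) G u v →
         V1 x ≡ true → V1 y ≡ true →
         adj G x u ≡ true → adj G y v ≡ true → x ≡ y)

data CWExpr (k : ℕ) : ℕ → Set where
  empty  : CWExpr k 0
  vertex : Fin k → CWExpr k 1
  union  : ∀ {m n} → CWExpr k m → CWExpr k n → CWExpr k (m + n)
  join   : ∀ {n} (i j : Fin k) → i ≢ j → CWExpr k n → CWExpr k n
  rename : ∀ {n} (i j : Fin k) → CWExpr k n → CWExpr k n

record LGraph (k n : ℕ) : Set where
  field
    ladj  : Fin n → Fin n → Bool
    label : Fin n → Fin k

open LGraph public

_==_ : ∀ {k} → Fin k → Fin k → Bool
i == j = ⌊ i ≟ j ⌋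

unionAdj : ∀ {m n} → (Fin m → Fin m → Bool) → (Fin n → Fin n → Bool) →
           Fin m ⊎ Fin n → Fin m ⊎ Fin n → Bool
unionAdj A B (inj₁ a) (inj₁ b) = A a b
unionAdj A B (inj₂ a) (inj₂ b) = B a b
unionAdj A B _ _ = false

⟦_⟧ : ∀ {k n} → CWExpr k n → LGraph k n
⟦ empty ⟧ = record { ladj = λ () ; label = λ () }
⟦ vertex i ⟧ = record { ladj = λ _ _ → false ; label = λ _ → i }
⟦ union {m} e f ⟧ = record
  { ladj  = λ u v → unionAdj (ladj ⟦ e ⟧) (ladj ⟦ f ⟧) (splitAt m u) (splitAt m v)
  ; label = λ u → [ label ⟦ e ⟧ , label ⟦ f ⟧ ] (splitAt m u) }
⟦ join i j _ e ⟧ = record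
  { ladj  = λ u v → ladj ⟦ e ⟧ u v
                    ∨ ((label ⟦ e ⟧ u == i) ∧ (label ⟦ e ⟧ v == j))
                    ∨ ((label ⟦ e ⟧ u == j) ∧ (label ⟦ e ⟧ v == i))
  ; label = label ⟦ e ⟧ }
⟦ rename i j e ⟧ = record
  { ladj  = ladj ⟦ e ⟧
  ; label = λ u → if label ⟦ e ⟧ u == i then j else label ⟦ e ⟧ u }

CliqueWidthAtMost : ∀ {n} → ℕ → Graph n → Set
CliqueWidthAtMost {n} k G =
  Σ (CWExpr k n) λ e → Σ (Fin n ↔ Fin n) λ φ →
    ∀ u v → ladj ⟦ e ⟧ u v ≡ adj G (Inverse.to φ u) (Inverse.to φ v)

module Submission where

-- Every nonempty vertex list W of G[V2] contains a
--    vertex that, inside W, is isolated, pendant, or has a true twin: a greedily grown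
--    walk stays an induced path (chordality, diamond-freeness), so it stops within n
--    steps, and it only stops at such a vertex.
-- 2. Pieces with 3 labels (Substitution, PruningSteps, Pieces).  Adding the pruned
--    vertices back one at a time, V2 is covered by pairwise separated connected pieces,
--    each generated by an expression over labels {0,1,2} where label 2 is inert; a twin
--    or pendant vertex v of w is added by substituting a two-vertex expression for the
--    leaf of w.
-- 3. Marking (Marking).  Pairing each label with a bit ("adjacent to the anchor in V1")
--    gives an expression over 6 labels, later collapsed to M (marked) and D (dead).
-- 4. Assembly (Specs, Assembly).  Each x ∈ V1, labelled X, is joined to the marked
--    vertices of the pieces anchored at x; these parts are combined by joins between X
--    and a clique label Cl, and the pieces without V1-neighbour are added by a union.
--
-- Expressions carry explicit vertex names (Expressions); only at the end are they
-- compiled to the anonymous CWExpr of Defs (Realisation).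

open import Defs renaming (sym to adj-sym)
open import Data.Nat using (ℕ; zero; suc; _+_; _<_; _≤_; z≤n; s≤s; _%_; _≡ᵇ_)
import Data.Nat.Properties as ℕP
open import Data.Nat.DivMod using (m<n⇒m%n≡m; n%n≡0)
open import Data.Fin as F using (Fin; zero; suc; toℕ; splitAt)
import Data.Fin.Properties as FP
open import Data.Bool as B using (Bool; true; false; _∧_; _∨_; not; if_then_else_; T)
open import Data.Bool.Properties using (∨-assoc; ∨-comm; ∨-identityʳ; ∨-zeroʳ; ∨-conicalˡ; ∨-conicalʳ;
  ∧-zeroʳ; ∧-conicalˡ; ∧-conicalʳ; T-∧; T-≡)
open import Data.Sum using (_⊎_; inj₁; inj₂; [_,_])
open import Data.Product using (Σ; _×_; _,_; proj₁; proj₂)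
open import Data.List using (List; []; _∷_; length; map)
open import Data.List.Relation.Unary.All using (All; []; _∷_)
open import Data.Unit using (⊤; tt)
open import Data.Empty using (⊥; ⊥-elim)
open import Relation.Binary.PropositionalEquality using (_≡_; _≢_; refl; sym; trans; cong; cong₂; subst)
open import Relation.Binary.Definitions using (tri<; tri≈; tri>)
open import Relation.Nullary using (Dec; yes; no; ¬_; _×-dec_)
open import Relation.Nullary.Decidable using (⌊_⌋)
open import Function.Bundles using (mk↔ₛ′; Equivalence)

∨-inl : ∀ {a b} → a ≡ true → a ∨ b ≡ true
∨-inl refl = refl

∨-inr : ∀ a {b} → b ≡ true → a ∨ b ≡ true
∨-inr false p = p
∨-inr true p = refl

∨-false : ∀ {a b} → a ≡ false → b ≡ false → a ∨ b ≡ false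
∨-false refl refl = refl

∨-cases : ∀ a {b} → a ∨ b ≡ true → a ≡ true ⊎ b ≡ true
∨-cases true _ = inj₁ refl
∨-cases false p = inj₂ p

true≢false : ∀ {a} → a ≡ true → a ≡ false → ⊥
true≢false refl ()

bool-⇔ : ∀ {a b} → (a ≡ true → b ≡ true) → (b ≡ true → a ≡ true) → a ≡ b
bool-⇔ {false} {false} _ _ = refl
bool-⇔ {false} {true} _ g with g refl
... | ()
bool-⇔ {true} {false} f _ with f refl
... | ()
bool-⇔ {true} {true} _ _ = refl

≟-true : ∀ {A : Set} {a b : A} (d : Dec (a ≡ b)) → ⌊ d ⌋ ≡ true → a ≡ b
≟-true (yes p) _ = p

≟-false : ∀ {A : Set} {a b : A} (d : Dec (a ≡ b)) → ⌊ d ⌋ ≡ false → a ≢ b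
≟-false (no p) _ = p

≟-refl : ∀ {A : Set} {a : A} (d : Dec (a ≡ a)) → ⌊ d ⌋ ≡ true
≟-refl (yes _) = refl
≟-refl (no p) = ⊥-elim (p refl)

≟-neq : ∀ {A : Set} {a b : A} (d : Dec (a ≡ b)) → a ≢ b → ⌊ d ⌋ ≡ false
≟-neq (yes p) q = ⊥-elim (q p)
≟-neq (no _) _ = refl

-- Identities between boolean functions of k variables are decided by evaluating them
-- at all 2^k points; used for a few bookkeeping identities with many variables.
BoolFun : ℕ → Set
BoolFun zero = Bool
BoolFun (suc k) = Bool → BoolFun k

_≋_ : ∀ {k} → BoolFun k → BoolFun k → Set
_≋_ {zero} f g = f ≡ g
_≋_ {suc k} f g = ∀ b → f b ≋ g b

agree : ∀ k → BoolFun k → BoolFun k → Bool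
agree zero f g = ⌊ f B.≟ g ⌋
agree (suc k) f g = agree k (f false) (g false) ∧ agree k (f true) (g true)

agree-sound : ∀ k (f g : BoolFun k) → T (agree k f g) → f ≋ g
agree-sound zero f g ok = ≟-true (f B.≟ g) (Equivalence.to T-≡ ok)
agree-sound (suc k) f g ok false = agree-sound k (f false) (g false) (proj₁ (Equivalence.to T-∧ ok))
agree-sound (suc k) f g ok true = agree-sound k (f true) (g true) (proj₂ (Equivalence.to T-∧ ok))

module VertexLists {n : ℕ} where
  V : Set
  V = Fin n

  eqV : V → V → Bool
  eqV a b = ⌊ a F.≟ b ⌋

  eqV-refl : ∀ w → eqV w w ≡ true
  eqV-refl w = ≟-refl (w F.≟ w)

  elem : V → List V → Bool
  elem y [] = false
  elem y (x ∷ xs) = eqV x y ∨ elem y xs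

  NoDup : List V → Set
  NoDup [] = ⊤
  NoDup (x ∷ xs) = elem x xs ≡ false × NoDup xs

  search : (p : V → Bool) (l : List V) →
           (Σ V λ y → elem y l ≡ true × p y ≡ true) ⊎ (∀ y → elem y l ≡ true → p y ≡ false)
  search p [] = inj₂ (λ y ())
  search p (x ∷ xs) with p x in px
  ... | true = inj₁ (x , ∨-inl (eqV-refl x) , px)
  ... | false with search p xs
  ...   | inj₁ (y , m , q) = inj₁ (y , ∨-inr (eqV x y) m , q)
  ...   | inj₂ h = inj₂ none
    where
    none : ∀ y → eqV x y ∨ elem y xs ≡ true → p y ≡ false
    none y m with x F.≟ y
    ... | yes refl = px
    ... | no _ = h y m

  keep : (V → Bool) → List V → List V
  keep p [] = []
  keep p (x ∷ l) = if p x then x ∷ keep p l else keep p l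

  elem-keep : ∀ p l y → elem y (keep p l) ≡ elem y l ∧ p y
  elem-keep p [] y = refl
  elem-keep p (x ∷ l) y with x F.≟ y
  ... | yes refl with p x in px
  ...   | true rewrite ≟-refl (x F.≟ x) = refl
  ...   | false = trans (elem-keep p l x) (trans (cong (elem x l ∧_) px) (∧-zeroʳ _))
  elem-keep p (x ∷ l) y | no q with p x
  ... | true rewrite ≟-neq (x F.≟ y) q = elem-keep p l y
  ... | false = elem-keep p l y

  elem-keep⁻ : ∀ p l y → elem y (keep p l) ≡ true → elem y l ≡ true × p y ≡ true
  elem-keep⁻ p l y m = ∧-conicalˡ _ _ m' , ∧-conicalʳ _ _ m'
    where m' = trans (sym (elem-keep p l y)) m

  elem-keep⁺ : ∀ p l y → elem y l ≡ true → p y ≡ true → elem y (keep p l) ≡ true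
  elem-keep⁺ p l y m py rewrite elem-keep p l y | m | py = refl

  keep-NoDup : ∀ p l → NoDup l → NoDup (keep p l)
  keep-NoDup p [] _ = tt
  keep-NoDup p (x ∷ l) (h , d) with p x
  ... | true = trans (elem-keep p l x) (cong (_∧ p x) h) , keep-NoDup p l d
  ... | false = keep-NoDup p l d

  keep-length : ∀ p l → length (keep p l) ≤ length l
  keep-length p [] = z≤n
  keep-length p (x ∷ l) with p x
  ... | true = s≤s (keep-length p l)
  ... | false = ℕP.m≤n⇒m≤1+n (keep-length p l)

  keep-shorter : ∀ p l v → elem v l ≡ true → p v ≡ false → length (keep p l) < length l
  keep-shorter p [] v () _
  keep-shorter p (x ∷ l) v m pv with ∨-cases (eqV x v) m
  ... | inj₁ q with ≟-true (x F.≟ v) q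
  ...   | refl rewrite pv = s≤s (keep-length p l)
  keep-shorter p (x ∷ l) v m pv | inj₂ q with p x
  ... | true = s≤s (keep-shorter p l v q pv)
  ... | false = ℕP.m≤n⇒m≤1+n (keep-shorter p l v q pv)

allVertices : ∀ m → List (Fin m)
allVertices zero = []
allVertices (suc m) = zero ∷ map suc (allVertices m)

module _ where
  open VertexLists

  private
    eqV-suc : ∀ {m} (a b : Fin m) → eqV (suc a) (suc b) ≡ eqV a b
    eqV-suc a b with a F.≟ b
    ... | yes refl = refl
    ... | no _ = refl

    elem-suc : ∀ {m} (l : List (Fin m)) y → elem (suc y) (map suc l) ≡ elem y l
    elem-suc [] y = refl
    elem-suc (x ∷ l) y rewrite eqV-suc x y | elem-suc l y = refl

    elem-zero : ∀ {m} (l : List (Fin m)) → elem zero (map suc l) ≡ false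
    elem-zero [] = refl
    elem-zero (x ∷ l) = elem-zero l

    NoDup-suc : ∀ {m} (l : List (Fin m)) → NoDup l → NoDup (map suc l)
    NoDup-suc [] _ = tt
    NoDup-suc (x ∷ l) (h , d) = trans (elem-suc l x) h , NoDup-suc l d

  allVertices-complete : ∀ m (y : Fin m) → elem y (allVertices m) ≡ true
  allVertices-complete (suc m) zero = refl
  allVertices-complete (suc m) (suc y) = trans (elem-suc (allVertices m) y) (allVertices-complete m y)

  allVertices-NoDup : ∀ m → NoDup (allVertices m)
  allVertices-NoDup zero = tt
  allVertices-NoDup (suc m) = elem-zero (allVertices m) , NoDup-suc (allVertices m) (allVertices-NoDup m)

-- An expression over label type L builds a labelled
-- graph on a subset of the vertex names Fin n; mem, lab and edge give that subset, the
-- labels and the edges.  Unions are meaningful only between disjoint expressions,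
-- which WellFormed records.

module Expressions {n : ℕ} {L : Set} (_≟L_ : (a b : L) → Dec (a ≡ b)) (dflt : L) where
  open VertexLists {n} using (V; eqV; eqV-refl) public

  eqL : L → L → Bool
  eqL a b = ⌊ a ≟L b ⌋

  data Expr : Set where
    emp  : Expr
    leaf : V → L → Expr
    un   : Expr → Expr → Expr
    jn   : (i j : L) → i ≢ j → Expr → Expr
    rn   : (i j : L) → Expr → Expr

  mem : Expr → V → Bool
  mem emp x = false
  mem (leaf v ℓ) x = eqV v x
  mem (un e f) x = mem e x ∨ mem f x
  mem (jn i j _ e) x = mem e x
  mem (rn i j e) x = mem e x

  lab : Expr → V → L
  lab emp x = dflt
  lab (leaf v ℓ) x = ℓ
  lab (un e f) x = if mem e x then lab e x else lab f x
  lab (jn i j _ e) x = lab e x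
  lab (rn i j e) x = if eqL (lab e x) i then j else lab e x

  joined : L → L → L → L → Bool
  joined i j a b = (eqL a i ∧ eqL b j) ∨ (eqL a j ∧ eqL b i)

  edge : Expr → V → V → Bool
  edge emp x y = false
  edge (leaf v ℓ) x y = false
  edge (un e f) x y = edge e x y ∨ edge f x y
  edge (jn i j _ e) x y = edge e x y ∨ (mem e x ∧ mem e y ∧ joined i j (lab e x) (lab e y))
  edge (rn i j e) x y = edge e x y

  Disj : Expr → Expr → Set
  Disj e f = ∀ x → mem e x ≡ true → mem f x ≡ false

  WellFormed : Expr → Set
  WellFormed emp = ⊤
  WellFormed (leaf _ _) = ⊤
  WellFormed (un e f) = WellFormed e × WellFormed f × Disj e f
  WellFormed (jn _ _ _ e) = WellFormed e
  WellFormed (rn _ _ e) = WellFormed e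

  -- number of leaves, and the enumeration of the leaves in the order of CWExpr's union
  size : Expr → ℕ
  size emp = 0
  size (leaf _ _) = 1
  size (un e f) = size e + size f
  size (jn _ _ _ e) = size e
  size (rn _ _ e) = size e

  vertexAt : (e : Expr) → Fin (size e) → V
  vertexAt emp ()
  vertexAt (leaf v _) _ = v
  vertexAt (un e f) i = [ vertexAt e , vertexAt f ] (splitAt (size e) i)
  vertexAt (jn _ _ _ e) i = vertexAt e i
  vertexAt (rn _ _ e) i = vertexAt e i

  vertexAt-mem : ∀ e p → mem e (vertexAt e p) ≡ true
  vertexAt-mem (leaf v _) p = eqV-refl v
  vertexAt-mem (un e f) p with splitAt (size e) p
  ... | inj₁ q = ∨-inl (vertexAt-mem e q)
  ... | inj₂ q = ∨-inr (mem e (vertexAt f q)) (vertexAt-mem f q)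
  vertexAt-mem (jn _ _ _ e) p = vertexAt-mem e p
  vertexAt-mem (rn _ _ e) p = vertexAt-mem e p

  vertexAt-onto : ∀ e x → mem e x ≡ true → Σ (Fin (size e)) λ p → vertexAt e p ≡ x
  vertexAt-onto emp x ()
  vertexAt-onto (leaf v _) x h = zero , ≟-true (v F.≟ x) h
  vertexAt-onto (un e f) x h with mem e x in me
  ... | true with vertexAt-onto e x me
  ...   | p , q = (p F.↑ˡ size f) ,
                  trans (cong [ vertexAt e , vertexAt f ] (FP.splitAt-↑ˡ (size e) p (size f))) q
  vertexAt-onto (un e f) x h | false with vertexAt-onto f x h
  ...   | p , q = (size e F.↑ʳ p) ,
                  trans (cong [ vertexAt e , vertexAt f ] (FP.splitAt-↑ʳ (size e) (size f) p)) q
  vertexAt-onto (jn _ _ _ e) x h = vertexAt-onto e x h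
  vertexAt-onto (rn _ _ e) x h = vertexAt-onto e x h

  vertexAt-injective : ∀ e → WellFormed e → ∀ p q → vertexAt e p ≡ vertexAt e q → p ≡ q
  vertexAt-injective emp _ () q
  vertexAt-injective (leaf _ _) _ zero zero _ = refl
  vertexAt-injective (un e f) (we , wf , d) p q h
    with splitAt (size e) p in ep | splitAt (size e) q in eq
  ... | inj₁ a | inj₁ b = trans (sym (FP.splitAt⁻¹-↑ˡ ep))
        (trans (cong (F._↑ˡ size f) (vertexAt-injective e we a b h)) (FP.splitAt⁻¹-↑ˡ eq))
  ... | inj₂ a | inj₂ b = trans (sym (FP.splitAt⁻¹-↑ʳ ep))
        (trans (cong (size e F.↑ʳ_) (vertexAt-injective f wf a b h)) (FP.splitAt⁻¹-↑ʳ eq))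
  ... | inj₁ a | inj₂ b = ⊥-elim (apart a b h)
    where
    apart : ∀ a b → vertexAt e a ≢ vertexAt f b
    apart a b eq = true≢false (subst (λ z → mem f z ≡ true) (sym eq) (vertexAt-mem f b))
                              (d (vertexAt e a) (vertexAt-mem e a))
  ... | inj₂ a | inj₁ b = ⊥-elim (apart b a (sym h))
    where
    apart : ∀ a b → vertexAt e a ≢ vertexAt f b
    apart a b eq = true≢false (subst (λ z → mem f z ≡ true) (sym eq) (vertexAt-mem f b))
                              (d (vertexAt e a) (vertexAt-mem e a))
  vertexAt-injective (jn _ _ _ e) w p q h = vertexAt-injective e w p q h
  vertexAt-injective (rn _ _ e) w p q h = vertexAt-injective e w p q h

  edge-mem : ∀ e x y → edge e x y ≡ true → mem e x ≡ true × mem e y ≡ true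
  edge-mem emp x y ()
  edge-mem (leaf _ _) x y ()
  edge-mem (un e f) x y h with ∨-cases (edge e x y) h
  ... | inj₁ p = ∨-inl (proj₁ (edge-mem e x y p)) , ∨-inl (proj₂ (edge-mem e x y p))
  ... | inj₂ p = ∨-inr (mem e x) (proj₁ (edge-mem f x y p)) , ∨-inr (mem e y) (proj₂ (edge-mem f x y p))
  edge-mem (jn i j _ e) x y h with ∨-cases (edge e x y) h
  ... | inj₁ p = edge-mem e x y p
  ... | inj₂ p = ∧-conicalˡ (mem e x) _ p , ∧-conicalˡ (mem e y) _ (∧-conicalʳ (mem e x) _ p)
  edge-mem (rn _ _ e) x y h = edge-mem e x y h

  edge-outˡ : ∀ e x y → mem e x ≡ false → edge e x y ≡ false
  edge-outˡ e x y h with edge e x y in eq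
  ... | false = refl
  ... | true = ⊥-elim (true≢false (proj₁ (edge-mem e x y eq)) h)

  edge-outʳ : ∀ e x y → mem e y ≡ false → edge e x y ≡ false
  edge-outʳ e x y h with edge e x y in eq
  ... | false = refl
  ... | true = ⊥-elim (true≢false (proj₂ (edge-mem e x y eq)) h)

  joined-sym : ∀ i j a b → joined i j a b ≡ joined i j b a
  joined-sym i j a b = agree-sound 4 (λ p q r s → (p ∧ q) ∨ (r ∧ s)) (λ p q r s → (s ∧ r) ∨ (q ∧ p)) tt
                         (eqL a i) (eqL b j) (eqL a j) (eqL b i)

  joined-irrefl : ∀ i j → i ≢ j → ∀ a → joined i j a a ≡ false
  joined-irrefl i j i≢j a with a ≟L i | a ≟L j
  ... | yes refl | yes refl = ⊥-elim (i≢j refl)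
  ... | yes refl | no _ = refl
  ... | no _ | yes refl = refl
  ... | no _ | no _ = refl

  edge-sym : ∀ e x y → edge e x y ≡ edge e y x
  edge-sym emp x y = refl
  edge-sym (leaf _ _) x y = refl
  edge-sym (un e f) x y = cong₂ _∨_ (edge-sym e x y) (edge-sym f x y)
  edge-sym (jn i j p e) x y =
    cong₂ _∨_ (edge-sym e x y)
      (trans (cong (λ b → mem e x ∧ mem e y ∧ b) (joined-sym i j (lab e x) (lab e y)))
             (agree-sound 3 (λ a b c → a ∧ b ∧ c) (λ a b c → b ∧ a ∧ c) tt
                            (mem e x) (mem e y) (joined i j (lab e y) (lab e x))))
  edge-sym (rn _ _ e) x y = edge-sym e x y

  edge-irrefl : ∀ e x → edge e x x ≡ false
  edge-irrefl emp x = refl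
  edge-irrefl (leaf _ _) x = refl
  edge-irrefl (un e f) x rewrite edge-irrefl e x | edge-irrefl f x = refl
  edge-irrefl (jn i j p e) x rewrite edge-irrefl e x | joined-irrefl i j p (lab e x)
    | ∧-zeroʳ (mem e x) | ∧-zeroʳ (mem e x) = refl
  edge-irrefl (rn _ _ e) x = edge-irrefl e x

-- Every occurrence of a vertex w in an expression e
-- exhibits e as  plug C (leaf w ℓ)  for a one-hole context C.  Replacing the leaf by an
-- expression F changes edges only through the labels F exposes to C: the edges among
-- context vertices stay (edge-plug-outside), a vertex of F with label ℓ sees exactly
-- the context vertices given by holeEdge C ℓ (edge-plug-mixed), and two vertices of F
-- acquire an edge from C exactly according to holeJoin (edge-plug-inside).

module Substitution {n : ℕ} {L : Set} (_≟L_ : (a b : L) → Dec (a ≡ b)) (dflt : L) where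
  open Expressions {n} _≟L_ dflt public

  data Context : Set where
    hole : Context
    unL  : Context → Expr → Context
    unR  : Expr → Context → Context
    jnC  : (i j : L) → i ≢ j → Context → Context
    rnC  : (i j : L) → Context → Context

  plug : Context → Expr → Expr
  plug hole F = F
  plug (unL C f) F = un (plug C F) f
  plug (unR f C) F = un f (plug C F)
  plug (jnC i j p C) F = jn i j p (plug C F)
  plug (rnC i j C) F = rn i j (plug C F)

  -- the final label of a hole vertex that had label ℓ inside the hole
  relabel : Context → L → L
  relabel hole ℓ = ℓ
  relabel (unL C f) ℓ = relabel C ℓ
  relabel (unR f C) ℓ = relabel C ℓ
  relabel (jnC _ _ _ C) ℓ = relabel C ℓ
  relabel (rnC i j C) ℓ = if eqL (relabel C ℓ) i then j else relabel C ℓ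

  ctxMem : Context → V → Bool
  ctxMem hole x = false
  ctxMem (unL C f) x = ctxMem C x ∨ mem f x
  ctxMem (unR f C) x = mem f x ∨ ctxMem C x
  ctxMem (jnC _ _ _ C) x = ctxMem C x
  ctxMem (rnC _ _ C) x = ctxMem C x

  ctxLab : Context → V → L
  ctxLab hole x = dflt
  ctxLab (unL C f) x = if ctxMem C x then ctxLab C x else lab f x
  ctxLab (unR f C) x = if mem f x then lab f x else ctxLab C x
  ctxLab (jnC _ _ _ C) x = ctxLab C x
  ctxLab (rnC i j C) x = if eqL (ctxLab C x) i then j else ctxLab C x

  ctxEdge : Context → V → V → Bool
  ctxEdge hole x y = false
  ctxEdge (unL C f) x y = ctxEdge C x y ∨ edge f x y
  ctxEdge (unR f C) x y = edge f x y ∨ ctxEdge C x y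
  ctxEdge (jnC i j _ C) x y = ctxEdge C x y ∨ (ctxMem C x ∧ ctxMem C y ∧ joined i j (ctxLab C x) (ctxLab C y))
  ctxEdge (rnC _ _ C) x y = ctxEdge C x y

  holeEdge : Context → L → V → Bool
  holeEdge hole ℓ y = false
  holeEdge (unL C f) ℓ y = holeEdge C ℓ y
  holeEdge (unR f C) ℓ y = holeEdge C ℓ y
  holeEdge (jnC i j _ C) ℓ y = holeEdge C ℓ y ∨ (ctxMem C y ∧ joined i j (relabel C ℓ) (ctxLab C y))
  holeEdge (rnC _ _ C) ℓ y = holeEdge C ℓ y

  holeJoin : Context → L → L → Bool
  holeJoin hole a b = false
  holeJoin (unL C f) a b = holeJoin C a b
  holeJoin (unR f C) a b = holeJoin C a b
  holeJoin (jnC i j _ C) a b = holeJoin C a b ∨ joined i j (relabel C a) (relabel C b)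
  holeJoin (rnC _ _ C) a b = holeJoin C a b

  ApartFrom : Context → Expr → Set
  ApartFrom C F = ∀ x → mem F x ≡ true → ctxMem C x ≡ false

  mem-plug : ∀ C F x → mem (plug C F) x ≡ ctxMem C x ∨ mem F x
  mem-plug hole F x = refl
  mem-plug (unL C f) F x rewrite mem-plug C F x =
    agree-sound 3 (λ c a b → (c ∨ a) ∨ b) (λ c a b → (c ∨ b) ∨ a) tt (ctxMem C x) (mem F x) (mem f x)
  mem-plug (unR f C) F x rewrite mem-plug C F x = sym (∨-assoc (mem f x) (ctxMem C x) (mem F x))
  mem-plug (jnC _ _ _ C) F x = mem-plug C F x
  mem-plug (rnC _ _ C) F x = mem-plug C F x

  mem-plug-out : ∀ C F x → mem F x ≡ false → mem (plug C F) x ≡ ctxMem C x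
  mem-plug-out C F x h rewrite mem-plug C F x | h = ∨-identityʳ (ctxMem C x)

  mem-plug-in : ∀ C F x → mem F x ≡ true → mem (plug C F) x ≡ true
  mem-plug-in C F x h rewrite mem-plug C F x | h = ∨-zeroʳ (ctxMem C x)

  lab-plug-out : ∀ C F x → mem F x ≡ false → ctxMem C x ≡ true → lab (plug C F) x ≡ ctxLab C x
  lab-plug-out hole F x h ()
  lab-plug-out (unL C f) F x h c rewrite mem-plug-out C F x h with ctxMem C x in cx
  ... | true = lab-plug-out C F x h cx
  ... | false = refl
  lab-plug-out (unR f C) F x h c with mem f x
  ... | true = refl
  ... | false = lab-plug-out C F x h c
  lab-plug-out (jnC _ _ _ C) F x h c = lab-plug-out C F x h c
  lab-plug-out (rnC i j C) F x h c rewrite lab-plug-out C F x h c = refl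

  apartˡ : ∀ {C f F} → ApartFrom (unL C f) F → ApartFrom C F
  apartˡ d x h = ∨-conicalˡ _ _ (d x h)
  apartˡ-sibling : ∀ {C f F} → ApartFrom (unL C f) F → ∀ x → mem F x ≡ true → mem f x ≡ false
  apartˡ-sibling d x h = ∨-conicalʳ _ _ (d x h)
  apartʳ : ∀ {C f F} → ApartFrom (unR f C) F → ApartFrom C F
  apartʳ d x h = ∨-conicalʳ _ _ (d x h)
  apartʳ-sibling : ∀ {C f F} → ApartFrom (unR f C) F → ∀ x → mem F x ≡ true → mem f x ≡ false
  apartʳ-sibling d x h = ∨-conicalˡ _ _ (d x h)

  lab-plug-in : ∀ C F → ApartFrom C F → ∀ x → mem F x ≡ true → lab (plug C F) x ≡ relabel C (lab F x)
  lab-plug-in hole F d x h = refl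
  lab-plug-in (unL C f) F d x h rewrite mem-plug-in C F x h = lab-plug-in C F (apartˡ {C} {f} {F} d) x h
  lab-plug-in (unR f C) F d x h rewrite apartʳ-sibling {C} {f} {F} d x h = lab-plug-in C F (apartʳ {C} {f} {F} d) x h
  lab-plug-in (jnC _ _ _ C) F d x h = lab-plug-in C F d x h
  lab-plug-in (rnC i j C) F d x h rewrite lab-plug-in C F d x h = refl

  edge-plug-outside : ∀ C F x y → mem F x ≡ false → mem F y ≡ false → edge (plug C F) x y ≡ ctxEdge C x y
  edge-plug-outside hole F x y hx hy = edge-outˡ F x y hx
  edge-plug-outside (unL C f) F x y hx hy rewrite edge-plug-outside C F x y hx hy = refl
  edge-plug-outside (unR f C) F x y hx hy rewrite edge-plug-outside C F x y hx hy = refl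
  edge-plug-outside (jnC i j _ C) F x y hx hy
    rewrite edge-plug-outside C F x y hx hy | mem-plug-out C F x hx | mem-plug-out C F y hy
    with ctxMem C x in cx | ctxMem C y in cy
  ... | true | true rewrite lab-plug-out C F x hx cx | lab-plug-out C F y hy cy = refl
  ... | true | false = refl
  ... | false | _ = refl
  edge-plug-outside (rnC _ _ C) F x y hx hy = edge-plug-outside C F x y hx hy

  edge-plug-mixed : ∀ C F → ApartFrom C F → ∀ x y → mem F x ≡ true → mem F y ≡ false →
                    edge (plug C F) x y ≡ holeEdge C (lab F x) y
  edge-plug-mixed hole F d x y hx hy = edge-outʳ F x y hy
  edge-plug-mixed (unL C f) F d x y hx hy
    rewrite edge-plug-mixed C F (apartˡ {C} {f} {F} d) x y hx hy
          | edge-outˡ f x y (apartˡ-sibling {C} {f} {F} d x hx) = ∨-identityʳ _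
  edge-plug-mixed (unR f C) F d x y hx hy
    rewrite edge-plug-mixed C F (apartʳ {C} {f} {F} d) x y hx hy
          | edge-outˡ f x y (apartʳ-sibling {C} {f} {F} d x hx) = refl
  edge-plug-mixed (jnC i j _ C) F d x y hx hy
    rewrite edge-plug-mixed C F d x y hx hy | mem-plug-in C F x hx | mem-plug-out C F y hy
          | lab-plug-in C F d x hx
    with ctxMem C y in cy
  ... | true rewrite lab-plug-out C F y hy cy = refl
  ... | false = refl
  edge-plug-mixed (rnC _ _ C) F d x y hx hy = edge-plug-mixed C F d x y hx hy

  edge-plug-inside : ∀ C F → ApartFrom C F → ∀ x y → mem F x ≡ true → mem F y ≡ true →
                     edge (plug C F) x y ≡ edge F x y ∨ holeJoin C (lab F x) (lab F y)
  edge-plug-inside hole F d x y hx hy = sym (∨-identityʳ _)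
  edge-plug-inside (unL C f) F d x y hx hy
    rewrite edge-plug-inside C F (apartˡ {C} {f} {F} d) x y hx hy
          | edge-outˡ f x y (apartˡ-sibling {C} {f} {F} d x hx) = ∨-identityʳ _
  edge-plug-inside (unR f C) F d x y hx hy
    rewrite edge-plug-inside C F (apartʳ {C} {f} {F} d) x y hx hy
          | edge-outˡ f x y (apartʳ-sibling {C} {f} {F} d x hx) = refl
  edge-plug-inside (jnC i j _ C) F d x y hx hy
    rewrite edge-plug-inside C F d x y hx hy | mem-plug-in C F x hx | mem-plug-in C F y hy
          | lab-plug-in C F d x hx | lab-plug-in C F d y hy = ∨-assoc (edge F x y) _ _
  edge-plug-inside (rnC _ _ C) F d x y hx hy = edge-plug-inside C F d x y hx hy

  decompose : ∀ e w → mem e w ≡ true → Σ Context λ C → Σ L λ ℓ → e ≡ plug C (leaf w ℓ)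
  decompose emp w ()
  decompose (leaf v ℓ) w h with ≟-true (v F.≟ w) h
  ... | refl = hole , ℓ , refl
  decompose (un e f) w h with mem e w in me
  ... | true with decompose e w me
  ...   | C , ℓ , refl = unL C f , ℓ , refl
  decompose (un e f) w h | false with decompose f w h
  ...   | C , ℓ , refl = unR e C , ℓ , refl
  decompose (jn i j p e) w h with decompose e w h
  ... | C , ℓ , refl = jnC i j p C , ℓ , refl
  decompose (rn i j e) w h with decompose e w h
  ... | C , ℓ , refl = rnC i j C , ℓ , refl

  wellFormed-apart : ∀ C F → WellFormed (plug C F) → ApartFrom C F
  wellFormed-apart hole F _ x _ = refl
  wellFormed-apart (unL C f) F (wp , wf , d) x h rewrite wellFormed-apart C F wp x h = d x (mem-plug-in C F x h)
  wellFormed-apart (unR f C) F (wf , wp , d) x h rewrite wellFormed-apart C F wp x h with mem f x in mf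
  ... | false = refl
  ... | true = ⊥-elim (true≢false (mem-plug-in C F x h) (d x mf))
  wellFormed-apart (jnC _ _ _ C) F w = wellFormed-apart C F w
  wellFormed-apart (rnC _ _ C) F w = wellFormed-apart C F w

  -- the context never joins the vertex at a leaf to itself, as edges are loop-free
  holeJoin-irrefl : ∀ C w ℓ → WellFormed (plug C (leaf w ℓ)) → holeJoin C ℓ ℓ ≡ false
  holeJoin-irrefl C w ℓ wf =
    trans (sym (edge-plug-inside C (leaf w ℓ) (wellFormed-apart C (leaf w ℓ) wf) w w (≟-refl (w F.≟ w)) (≟-refl (w F.≟ w))))
          (edge-irrefl (plug C (leaf w ℓ)) w)

  wellFormed-plug : ∀ C F F' → WellFormed (plug C F) → WellFormed F' →
                    (∀ x → mem F' x ≡ true → mem F x ≡ true ⊎ mem (plug C F) x ≡ false) →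
                    WellFormed (plug C F')
  wellFormed-plug hole F F' _ w' _ = w'
  wellFormed-plug (unL C f) F F' (wp , wf , d) w' h = wellFormed-plug C F F' wp w' h' , wf , d'
    where
    h' : ∀ x → mem F' x ≡ true → mem F x ≡ true ⊎ mem (plug C F) x ≡ false
    h' x m with h x m
    ... | inj₁ p = inj₁ p
    ... | inj₂ p = inj₂ (∨-conicalˡ _ _ p)
    d' : ∀ x → mem (plug C F') x ≡ true → mem f x ≡ false
    d' x m rewrite mem-plug C F' x with ctxMem C x in cx
    ... | true = d x (trans (mem-plug C F x) (cong (_∨ mem F x) cx))
    ... | false with h x m
    ...   | inj₁ p = d x (mem-plug-in C F x p)
    ...   | inj₂ p = ∨-conicalʳ _ _ p
  wellFormed-plug (unR f C) F F' (wf , wp , d) w' h = wf , wellFormed-plug C F F' wp w' h' , d'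
    where
    h' : ∀ x → mem F' x ≡ true → mem F x ≡ true ⊎ mem (plug C F) x ≡ false
    h' x m with h x m
    ... | inj₁ p = inj₁ p
    ... | inj₂ p = inj₂ (∨-conicalʳ _ _ p)
    d' : ∀ x → mem f x ≡ true → mem (plug C F') x ≡ false
    d' x m = trans (mem-plug C F' x)
               (∨-false (∨-conicalˡ _ _ (trans (sym (mem-plug C F x)) (d x m))) notInF')
      where
      notInF' : mem F' x ≡ false
      notInF' with mem F' x in m'
      ... | false = refl
      ... | true with h x m'
      ...   | inj₁ p = ⊥-elim (true≢false (mem-plug-in C F x p) (d x m))
      ...   | inj₂ p = ⊥-elim (true≢false m (∨-conicalˡ _ _ p))
  wellFormed-plug (jnC _ _ _ C) F F' w w' h = wellFormed-plug C F F' w w' h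
  wellFormed-plug (rnC _ _ C) F F' w w' h = wellFormed-plug C F F' w w' h

  -- An inert label z is never the source of a rename nor an argument of a join, and no
  -- leaf is created with it; a vertex that receives label z keeps it and gets no new edges.
  module Inert (z : L) where
    Uses-z-inertly : Expr → Set
    Uses-z-inertly emp = ⊤
    Uses-z-inertly (leaf _ ℓ) = ℓ ≢ z
    Uses-z-inertly (un e f) = Uses-z-inertly e × Uses-z-inertly f
    Uses-z-inertly (jn i j _ e) = i ≢ z × j ≢ z × Uses-z-inertly e
    Uses-z-inertly (rn i j e) = i ≢ z × Uses-z-inertly e

    CtxInert : Context → Set
    CtxInert hole = ⊤
    CtxInert (unL C f) = CtxInert C × Uses-z-inertly f
    CtxInert (unR f C) = Uses-z-inertly f × CtxInert C
    CtxInert (jnC i j _ C) = i ≢ z × j ≢ z × CtxInert C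
    CtxInert (rnC i j C) = i ≢ z × CtxInert C

    inert-split : ∀ C F → Uses-z-inertly (plug C F) → CtxInert C × Uses-z-inertly F
    inert-split hole F g = tt , g
    inert-split (unL C f) F (g , gf) = (proj₁ (inert-split C F g) , gf) , proj₂ (inert-split C F g)
    inert-split (unR f C) F (gf , g) = (gf , proj₁ (inert-split C F g)) , proj₂ (inert-split C F g)
    inert-split (jnC i j _ C) F (a , b , g) = (a , b , proj₁ (inert-split C F g)) , proj₂ (inert-split C F g)
    inert-split (rnC i j C) F (a , g) = (a , proj₁ (inert-split C F g)) , proj₂ (inert-split C F g)

    inert-plug : ∀ C F → CtxInert C → Uses-z-inertly F → Uses-z-inertly (plug C F)
    inert-plug hole F _ g = g
    inert-plug (unL C f) F (gc , gf) g = inert-plug C F gc g , gf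
    inert-plug (unR f C) F (gf , gc) g = gf , inert-plug C F gc g
    inert-plug (jnC i j _ C) F (a , b , gc) g = a , b , inert-plug C F gc g
    inert-plug (rnC i j C) F (a , gc) g = a , inert-plug C F gc g

    relabel-z : ∀ C → CtxInert C → relabel C z ≡ z
    relabel-z hole _ = refl
    relabel-z (unL C f) (g , _) = relabel-z C g
    relabel-z (unR f C) (_ , g) = relabel-z C g
    relabel-z (jnC _ _ _ C) (_ , _ , g) = relabel-z C g
    relabel-z (rnC i j C) (a , g) rewrite relabel-z C g | ≟-neq (z ≟L i) (λ q → a (sym q)) = refl

    joined-z : ∀ i j b → i ≢ z → j ≢ z → joined i j z b ≡ false
    joined-z i j b a c rewrite ≟-neq (z ≟L i) (λ q → a (sym q)) | ≟-neq (z ≟L j) (λ q → c (sym q)) = refl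

    holeEdge-z : ∀ C y → CtxInert C → holeEdge C z y ≡ false
    holeEdge-z hole y _ = refl
    holeEdge-z (unL C f) y (g , _) = holeEdge-z C y g
    holeEdge-z (unR f C) y (_ , g) = holeEdge-z C y g
    holeEdge-z (jnC i j _ C) y (a , b , g)
      rewrite holeEdge-z C y g | relabel-z C g | joined-z i j (ctxLab C y) a b = ∧-zeroʳ (ctxMem C y)
    holeEdge-z (rnC _ _ C) y (_ , g) = holeEdge-z C y g

    holeJoin-z : ∀ C b → CtxInert C → holeJoin C z b ≡ false
    holeJoin-z hole b _ = refl
    holeJoin-z (unL C f) b (g , _) = holeJoin-z C b g
    holeJoin-z (unR f C) b (_ , g) = holeJoin-z C b g
    holeJoin-z (jnC i j _ C) b (a , c , g) rewrite holeJoin-z C b g | relabel-z C g = joined-z i j (relabel C b) a c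
    holeJoin-z (rnC _ _ C) b (_ , g) = holeJoin-z C b g

-- Forgetting vertex names gives a
-- CWExpr; vertexAt is the required isomorphism.

module Realisation {n k : ℕ} (d0 : Fin k) where
  open Expressions {n} {Fin k} F._≟_ d0

  compile : (e : Expr) → CWExpr k (size e)
  compile emp = empty
  compile (leaf v ℓ) = vertex ℓ
  compile (un e f) = union (compile e) (compile f)
  compile (jn i j p e) = join i j p (compile e)
  compile (rn i j e) = rename i j (compile e)

  private
    outside : ∀ e f → Disj e f → ∀ a → mem e (vertexAt f a) ≡ false
    outside e f d a with mem e (vertexAt f a) in eq
    ... | false = refl
    ... | true = ⊥-elim (true≢false (vertexAt-mem f a) (d _ eq))

  compile-label : ∀ e → WellFormed e → ∀ p → label ⟦ compile e ⟧ p ≡ lab e (vertexAt e p)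
  compile-label emp _ ()
  compile-label (leaf v ℓ) _ p = refl
  compile-label (un e f) (we , wf , d) p with splitAt (size e) p
  ... | inj₁ a rewrite vertexAt-mem e a = compile-label e we a
  ... | inj₂ a rewrite outside e f d a = compile-label f wf a
  compile-label (jn i j x e) w p = compile-label e w p
  compile-label (rn i j e) w p rewrite compile-label e w p = refl

  compile-adj : ∀ e → WellFormed e → ∀ p q → ladj ⟦ compile e ⟧ p q ≡ edge e (vertexAt e p) (vertexAt e q)
  compile-adj emp _ ()
  compile-adj (leaf v ℓ) _ p q = refl
  compile-adj (un e f) (we , wf , d) p q with splitAt (size e) p | splitAt (size e) q
  ... | inj₁ a | inj₁ b rewrite edge-outˡ f (vertexAt e a) (vertexAt e b) (d _ (vertexAt-mem e a))
                              | compile-adj e we a b = sym (∨-identityʳ _)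
  ... | inj₂ a | inj₂ b rewrite edge-outˡ e (vertexAt f a) (vertexAt f b) (outside e f d a) = compile-adj f wf a b
  ... | inj₁ a | inj₂ b rewrite edge-outʳ e (vertexAt e a) (vertexAt f b) (outside e f d b)
                              | edge-outˡ f (vertexAt e a) (vertexAt f b) (d _ (vertexAt-mem e a)) = refl
  ... | inj₂ a | inj₁ b rewrite edge-outˡ e (vertexAt f a) (vertexAt e b) (outside e f d a)
                              | edge-outʳ f (vertexAt f a) (vertexAt e b) (d _ (vertexAt-mem e b)) = refl
  compile-adj (jn i j x e) w p q rewrite compile-adj e w p q | compile-label e w p | compile-label e w q
    | vertexAt-mem e p | vertexAt-mem e q = refl
  compile-adj (rn i j e) w p q = compile-adj e w p q

  realise : (G : Graph n) (e : Expr) → WellFormed e → (∀ x → mem e x ≡ true) →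
            (∀ x y → edge e x y ≡ adj G x y) → CliqueWidthAtMost k G
  realise G e w all ok =
    iso (compile e) (vertexAt e) from to∘from from∘to (λ p q → trans (compile-adj e w p q) (ok _ _)) size≡n
    where
    from : Fin n → Fin (size e)
    from y = proj₁ (vertexAt-onto e y (all y))
    to∘from : ∀ y → vertexAt e (from y) ≡ y
    to∘from y = proj₂ (vertexAt-onto e y (all y))
    from∘to : ∀ p → from (vertexAt e p) ≡ p
    from∘to p = vertexAt-injective e w _ _ (to∘from (vertexAt e p))
    size≡n : size e ≡ n
    size≡n = ℕP.≤-antisym (FP.injective⇒≤ (λ {p} {q} → vertexAt-injective e w p q))
                          (FP.injective⇒≤ {f = from} (λ {x} {y} eq →
                             trans (sym (to∘from x)) (trans (cong (vertexAt e) eq) (to∘from y))))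
    iso : ∀ {m} (c : CWExpr k m) (to : Fin m → Fin n) (from : Fin n → Fin m) →
          (∀ y → to (from y) ≡ y) → (∀ p → from (to p) ≡ p) →
          (∀ p q → ladj ⟦ c ⟧ p q ≡ adj G (to p) (to q)) → m ≡ n → CliqueWidthAtMost k G
    iso c to from r l h refl = c , mk↔ₛ′ to from r l , h

module Adjacency {n : ℕ} (G : Graph n) where
  A : Fin n → Fin n → Bool
  A = adj G

  A-sym : ∀ {u v} → A u v ≡ true → A v u ≡ true
  A-sym {u} {v} h = trans (adj-sym G v u) h

  A-neq : ∀ {u v} → A u v ≡ true → u ≢ v
  A-neq {u} h refl = true≢false h (irrefl G u)

-- Prepending x to an induced path y₀ y₁ … whose first
-- contact with x after y₀ were y_k (k ≥ 2) would close the chordless cycle x y₀ … y_k.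

module ChordalPaths {n : ℕ} (G : Graph n) (S : Fin n → Bool) (chordal : ChordalOn S G) where
  open Adjacency G
  private
    V = Fin n

  -- lookup with a default vertex (indices are always checked against the length)
  at : V → List V → ℕ → V
  at d [] i = d
  at d (x ∷ xs) zero = x
  at d (x ∷ xs) (suc i) = at d xs i

  AllIn : List V → Set
  AllIn = All (λ x → S x ≡ true)

  at-in : ∀ d ys i → AllIn ys → i < length ys → S (at d ys i) ≡ true
  at-in d (y ∷ ys) zero (p ∷ _) _ = p
  at-in d (y ∷ ys) (suc i) (_ ∷ ps) (s≤s h) = at-in d ys i ps h

  LocallyInduced : List V → Set
  LocallyInduced [] = ⊤
  LocallyInduced (x ∷ []) = ⊤
  LocallyInduced (x ∷ y ∷ []) = A x y ≡ true
  LocallyInduced (x ∷ y ∷ z ∷ r) = A x y ≡ true × x ≢ z × A x z ≡ false × LocallyInduced (y ∷ z ∷ r)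

  LocallyInduced-tail : ∀ x xs → LocallyInduced (x ∷ xs) → LocallyInduced xs
  LocallyInduced-tail x [] _ = tt
  LocallyInduced-tail x (y ∷ []) _ = tt
  LocallyInduced-tail x (y ∷ z ∷ r) (_ , _ , _ , h) = h

  LocallyInduced-head : ∀ x y r → LocallyInduced (x ∷ y ∷ r) → A x y ≡ true
  LocallyInduced-head x y [] h = h
  LocallyInduced-head x y (z ∷ r) h = proj₁ h

  Distinct OnlyConsecutive Consecutive : V → List V → Set
  Distinct d ys = ∀ i j → i < length ys → j < length ys → at d ys i ≡ at d ys j → i ≡ j
  OnlyConsecutive d ys = ∀ i j → i < length ys → j < length ys → A (at d ys i) (at d ys j) ≡ true →
                         j ≡ suc i ⊎ i ≡ suc j
  Consecutive d ys = ∀ i → suc i < length ys → A (at d ys i) (at d ys (suc i)) ≡ true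

  module CycleIndices (m : ℕ) where
    N : ℕ
    N = 4 + m

    Next : ℕ → ℕ → Set
    Next a b = b ≡ suc a ⊎ (suc a ≡ N × b ≡ 0)

    next-mod : ∀ a → a < N → (suc a < N × (a + 1) % N ≡ suc a) ⊎ (suc a ≡ N × (a + 1) % N ≡ 0)
    next-mod a h with ℕP.m≤n⇒m<n∨m≡n h
    ... | inj₁ lt = inj₁ (lt , trans (cong (_% N) (ℕP.+-comm a 1)) (m<n⇒m%n≡m lt))
    ... | inj₂ eq = inj₂ (eq , trans (cong (_% N) (trans (ℕP.+-comm a 1) eq)) (n%n≡0 N))

    ≡ᵇ-sound : ∀ a b → (a ≡ᵇ b) ≡ true → a ≡ b
    ≡ᵇ-sound a b h = ℕP.≡ᵇ⇒≡ a b (Equivalence.from T-≡ h)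

    ≡ᵇ-refl : ∀ a → (a ≡ᵇ a) ≡ true
    ≡ᵇ-refl zero = refl
    ≡ᵇ-refl (suc a) = ≡ᵇ-refl a

    cycle-next : ∀ a b → a < N → (((a + 1) % N) ≡ᵇ b) ≡ true → Next a b
    cycle-next a b h e with next-mod a h
    ... | inj₁ (_ , q) = inj₁ (sym (trans (sym q) (≡ᵇ-sound _ _ e)))
    ... | inj₂ (r , q) = inj₂ (r , sym (trans (sym q) (≡ᵇ-sound _ _ e)))

    next-cycle : ∀ a b → a < N → b < N → Next a b → (((a + 1) % N) ≡ᵇ b) ≡ true
    next-cycle a b h hb s with next-mod a h | s
    ... | inj₁ (_ , q) | inj₁ refl rewrite q = ≡ᵇ-refl (suc a)
    ... | inj₁ (lt , _) | inj₂ (r , _) = ⊥-elim (ℕP.<-irrefl r lt)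
    ... | inj₂ (r , _) | inj₁ refl = ⊥-elim (ℕP.<-irrefl r hb)
    ... | inj₂ (_ , q) | inj₂ (_ , refl) rewrite q = refl

  module Prepend (d x : V) (ys : List V) (sx : S x ≡ true) (sys : AllIn ys)
                 (dist : Distinct d ys) (only : OnlyConsecutive d ys) (cons : Consecutive d ys)
                 (x~y₀ : A x (at d ys 0) ≡ true)
                 (x≁y₁ : 1 < length ys → x ≢ at d ys 1 × A x (at d ys 1) ≡ false) where
    len : ℕ
    len = length ys

    Contact : ℕ → Set
    Contact k = A x (at d ys k) ≡ true ⊎ x ≡ at d ys k

    path : ℕ → V
    path = at d (x ∷ ys)

    -- if the first contact after y₀ is an edge x y_k with k ≥ 2, x y₀ … y_k is an
    -- induced cycle of length k + 2 ≥ 4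
    module FirstContact (m : ℕ) (k<len : suc (suc m) < len) (x~yₖ : A x (at d ys (suc (suc m))) ≡ true)
                        (earlier : ∀ i → i < suc (suc m) → 1 ≤ i → ¬ Contact i) where
      open CycleIndices m
      k : ℕ
      k = suc (suc m)

      in-path : ∀ j → suc j < N → j < len
      in-path j (s≤s h) = ℕP.≤-trans h k<len

      neighbours-of-x : ∀ j → suc j < N → A x (at d ys j) ≡ true → Next 0 (suc j) ⊎ Next (suc j) 0
      neighbours-of-x zero _ _ = inj₁ (inj₁ refl)
      neighbours-of-x (suc j) hb h with ℕP.<-cmp (suc j) k
      ... | tri< lt _ _ = ⊥-elim (earlier (suc j) lt (s≤s z≤n) (inj₁ h))
      ... | tri≈ _ refl _ = inj₂ (inj₂ (refl , refl))
      ... | tri> _ _ gt = ⊥-elim (ℕP.<-irrefl refl (ℕP.≤-trans hb (s≤s gt)))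

      swap : ∀ {a b} → Next a b ⊎ Next b a → Next b a ⊎ Next a b
      swap (inj₁ p) = inj₂ p
      swap (inj₂ p) = inj₁ p

      adjacent⇒next : ∀ a b → a < N → b < N → A (path a) (path b) ≡ true → Next a b ⊎ Next b a
      adjacent⇒next zero zero _ _ h = ⊥-elim (A-neq h refl)
      adjacent⇒next zero (suc j) _ hb h = neighbours-of-x j hb h
      adjacent⇒next (suc i) zero ha _ h = swap (neighbours-of-x i ha (A-sym h))
      adjacent⇒next (suc i) (suc j) ha hb h with only i j (in-path i ha) (in-path j hb) h
      ... | inj₁ e = inj₁ (inj₁ (cong suc e))
      ... | inj₂ e = inj₂ (inj₁ (cong suc e))

      next⇒adjacent : ∀ a b → a < N → b < N → Next a b → A (path a) (path b) ≡ true
      next⇒adjacent zero .1 _ _ (inj₁ refl) = x~y₀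
      next⇒adjacent (suc i) .(suc (suc i)) _ hb (inj₁ refl) = cons i (in-path (suc i) hb)
      next⇒adjacent (suc i) .0 _ _ (inj₂ (refl , refl)) = A-sym x~yₖ

      x∉path : ∀ j → suc j < N → x ≢ at d ys j
      x∉path zero _ e = A-neq x~y₀ e
      x∉path (suc j) hb e with ℕP.<-cmp (suc j) k
      ... | tri< lt _ _ = earlier (suc j) lt (s≤s z≤n) (inj₂ e)
      ... | tri≈ _ refl _ = A-neq x~yₖ e
      ... | tri> _ _ gt = ℕP.<-irrefl refl (ℕP.≤-trans hb (s≤s gt))

      path-injective : ∀ a b → a < N → b < N → path a ≡ path b → a ≡ b
      path-injective zero zero _ _ _ = refl
      path-injective zero (suc j) _ hb e = ⊥-elim (x∉path j hb e)
      path-injective (suc i) zero ha _ e = ⊥-elim (x∉path i ha (sym e))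
      path-injective (suc i) (suc j) ha hb e = cong suc (dist i j (in-path i ha) (in-path j hb) e)

      cycle : Fin N → V
      cycle a = path (toℕ a)

      chordless-cycle : ⊥
      chordless-cycle = chordal m (cycle , inj , inS , adjacency)
        where
        inj : ∀ {a b} → cycle a ≡ cycle b → a ≡ b
        inj {a} {b} e = FP.toℕ-injective (path-injective (toℕ a) (toℕ b) (FP.toℕ<n a) (FP.toℕ<n b) e)
        inS : ∀ a → S (cycle a) ≡ true
        inS a with toℕ a | FP.toℕ<n a
        ... | zero | _ = sx
        ... | suc i | h = at-in d ys i sys (in-path i h)
        adjacency : ∀ a b → cycleAdj m a b ≡ A (cycle a) (cycle b)
        adjacency a b = bool-⇔ to from
          where
          ta = FP.toℕ<n a
          tb = FP.toℕ<n b
          to : cycleAdj m a b ≡ true → A (cycle a) (cycle b) ≡ true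
          to h with ∨-cases (((toℕ a + 1) % N) ≡ᵇ toℕ b) h
          ... | inj₁ p = next⇒adjacent (toℕ a) (toℕ b) ta tb (cycle-next (toℕ a) (toℕ b) ta p)
          ... | inj₂ p = A-sym (next⇒adjacent (toℕ b) (toℕ a) tb ta (cycle-next (toℕ b) (toℕ a) tb p))
          from : A (cycle a) (cycle b) ≡ true → cycleAdj m a b ≡ true
          from h with adjacent⇒next (toℕ a) (toℕ b) ta tb h
          ... | inj₁ s = ∨-inl (next-cycle (toℕ a) (toℕ b) ta tb s)
          ... | inj₂ s = ∨-inr (((toℕ a + 1) % N) ≡ᵇ toℕ b) (next-cycle (toℕ b) (toℕ a) tb ta s)

    -- the first contact cannot be y₁ (by assumption), a later edge (chordless cycle), or a
    -- later equality x = y_k (then y_{k-1} would be an earlier contact)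
    no-first-contact : ∀ k → (∀ i → i < k → 1 ≤ i → ¬ Contact i) → k < len → 1 ≤ k → ¬ Contact k
    no-first-contact zero _ _ ()
    no-first-contact (suc zero) _ lt _ (inj₁ h) = true≢false h (proj₂ (x≁y₁ lt))
    no-first-contact (suc zero) _ lt _ (inj₂ h) = proj₁ (x≁y₁ lt) h
    no-first-contact (suc (suc m)) earlier lt _ (inj₁ h) = FirstContact.chordless-cycle m lt h earlier
    no-first-contact (suc (suc m)) earlier lt _ (inj₂ e) =
      earlier (suc m) ℕP.≤-refl (s≤s z≤n)
        (inj₁ (A-sym (subst (λ z → A (at d ys (suc m)) z ≡ true) (sym e) (cons (suc m) lt))))

    no-contact-below : ∀ k i → i < k → i < len → 1 ≤ i → ¬ Contact i
    no-contact-below (suc k) i (s≤s i≤k) il with ℕP.m≤n⇒m<n∨m≡n i≤k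
    ... | inj₁ lt = no-contact-below k i lt il
    ... | inj₂ refl = no-first-contact i (λ i' lt' → no-contact-below i i' lt' (ℕP.<-trans lt' il)) il

    no-contact : ∀ i → i < len → 1 ≤ i → ¬ Contact i
    no-contact i il = no-contact-below (suc i) i ℕP.≤-refl il

    distinct : Distinct d (x ∷ ys)
    distinct zero zero _ _ _ = refl
    distinct zero (suc zero) _ _ e = ⊥-elim (A-neq x~y₀ e)
    distinct zero (suc (suc j)) _ (s≤s jl) e = ⊥-elim (no-contact (suc j) jl (s≤s z≤n) (inj₂ e))
    distinct (suc zero) zero _ _ e = ⊥-elim (A-neq x~y₀ (sym e))
    distinct (suc (suc i)) zero (s≤s il) _ e = ⊥-elim (no-contact (suc i) il (s≤s z≤n) (inj₂ (sym e)))
    distinct (suc i) (suc j) (s≤s il) (s≤s jl) e = cong suc (dist i j il jl e)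

    onlyConsecutive : OnlyConsecutive d (x ∷ ys)
    onlyConsecutive zero zero _ _ h = ⊥-elim (A-neq h refl)
    onlyConsecutive zero (suc zero) _ _ h = inj₁ refl
    onlyConsecutive zero (suc (suc j)) _ (s≤s jl) h = ⊥-elim (no-contact (suc j) jl (s≤s z≤n) (inj₁ h))
    onlyConsecutive (suc zero) zero _ _ h = inj₂ refl
    onlyConsecutive (suc (suc i)) zero (s≤s il) _ h = ⊥-elim (no-contact (suc i) il (s≤s z≤n) (inj₁ (A-sym h)))
    onlyConsecutive (suc i) (suc j) (s≤s il) (s≤s jl) h with only i j il jl h
    ... | inj₁ e = inj₁ (cong suc e)
    ... | inj₂ e = inj₂ (cong suc e)

    consecutive : Consecutive d (x ∷ ys)
    consecutive zero _ = x~y₀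
    consecutive (suc i) (s≤s h) = cons i h

  locally-induced⇒induced : ∀ d xs → LocallyInduced xs → AllIn xs →
                            Distinct d xs × OnlyConsecutive d xs × Consecutive d xs
  locally-induced⇒induced d [] _ _ = (λ i j ()) , (λ i j ()) , (λ i ())
  locally-induced⇒induced d (x ∷ []) _ _ =
    (λ { zero zero _ _ _ → refl ; zero (suc j) _ (s≤s ()) _ ; (suc i) _ (s≤s ()) _ _ }) ,
    (λ { zero zero _ _ h → ⊥-elim (A-neq h refl) ; zero (suc j) _ (s≤s ()) _ ; (suc i) _ (s≤s ()) _ _ }) ,
    (λ { i (s≤s ()) })
  locally-induced⇒induced d (x ∷ y ∷ r) li (sx ∷ sys)
    with locally-induced⇒induced d (y ∷ r) (LocallyInduced-tail x (y ∷ r) li) sys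
  ... | (dist , only , cons) = P.distinct , P.onlyConsecutive , P.consecutive
    where
    second-apart : ∀ r → LocallyInduced (x ∷ y ∷ r) → 1 < length (y ∷ r) →
                   x ≢ at d (y ∷ r) 1 × A x (at d (y ∷ r) 1) ≡ false
    second-apart (z ∷ _) (_ , p , q , _) _ = p , q
    second-apart [] _ (s≤s ())
    module P = Prepend d x (y ∷ r) sx sys dist only cons (LocallyInduced-head x y r li) (second-apart r li)

  induced-length : ∀ ws → LocallyInduced ws → AllIn ws → length ws ≤ n
  induced-length [] _ _ = z≤n
  induced-length (v ∷ r) li s = FP.injective⇒≤ {f = h} inj
    where
    dist = proj₁ (locally-induced⇒induced v (v ∷ r) li s)
    h : Fin (length (v ∷ r)) → Fin n
    h i = at v (v ∷ r) (toℕ i)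
    inj : ∀ {i j} → h i ≡ h j → i ≡ j
    inj {i} {j} e = FP.toℕ-injective (dist (toℕ i) (toℕ j) (FP.toℕ<n i) (FP.toℕ<n j) e)

-- A greedy walk in W is kept locally induced
-- (hence induced, hence of length at most n):
--   * from a single vertex v, step to any neighbour, else v is isolated;
--   * from v u …, step to a neighbour y of v not adjacent (and not equal) to u;
--   * otherwise all other neighbours of v are adjacent to u.  If there are none, v is
--     pendant on u.  Else take such a neighbour w; a neighbour z of w outside N[v] lets
--     the walk restart as z w u … (one longer), and without one w is a twin of v:
--     a vertex y seen by v but not by w would give the diamond w u v y.

module Pruning {n : ℕ} (G : Graph n) (S : Fin n → Bool)
               (diamondFree : FreeOn S G diamondAdj) (chordal : ChordalOn S G) where
  open Adjacency G
  open ChordalPaths G S chordal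
  open VertexLists {n}

  -- a, d are the two non-adjacent vertices of the would-be diamond a b c d
  no-diamond : ∀ a b c d → S a ≡ true → S b ≡ true → S c ≡ true → S d ≡ true →
               A a b ≡ true → A a c ≡ true → A b c ≡ true → A b d ≡ true → A c d ≡ true →
               A a d ≡ false → a ≢ d → ⊥
  no-diamond a b c d sa sb sc sd ab ac bc bd cd ad a≢d = diamondFree (f , inj , inS , adjacency)
    where
    f : Fin 4 → V
    f zero = a
    f (suc zero) = b
    f (suc (suc zero)) = c
    f (suc (suc (suc zero))) = d
    inj : ∀ {i j} → f i ≡ f j → i ≡ j
    inj {zero} {zero} h = refl
    inj {zero} {suc zero} h = ⊥-elim (A-neq ab h)
    inj {zero} {suc (suc zero)} h = ⊥-elim (A-neq ac h)
    inj {zero} {suc (suc (suc zero))} h = ⊥-elim (a≢d h)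
    inj {suc zero} {zero} h = ⊥-elim (A-neq ab (sym h))
    inj {suc zero} {suc zero} h = refl
    inj {suc zero} {suc (suc zero)} h = ⊥-elim (A-neq bc h)
    inj {suc zero} {suc (suc (suc zero))} h = ⊥-elim (A-neq bd h)
    inj {suc (suc zero)} {zero} h = ⊥-elim (A-neq ac (sym h))
    inj {suc (suc zero)} {suc zero} h = ⊥-elim (A-neq bc (sym h))
    inj {suc (suc zero)} {suc (suc zero)} h = refl
    inj {suc (suc zero)} {suc (suc (suc zero))} h = ⊥-elim (A-neq cd h)
    inj {suc (suc (suc zero))} {zero} h = ⊥-elim (a≢d (sym h))
    inj {suc (suc (suc zero))} {suc zero} h = ⊥-elim (A-neq bd (sym h))
    inj {suc (suc (suc zero))} {suc (suc zero)} h = ⊥-elim (A-neq cd (sym h))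
    inj {suc (suc (suc zero))} {suc (suc (suc zero))} h = refl
    inS : ∀ i → S (f i) ≡ true
    inS zero = sa
    inS (suc zero) = sb
    inS (suc (suc zero)) = sc
    inS (suc (suc (suc zero))) = sd
    loop-free : ∀ v → false ≡ A v v
    loop-free v = sym (irrefl G v)
    adjacency : ∀ i j → diamondAdj i j ≡ A (f i) (f j)
    adjacency zero zero = loop-free a
    adjacency zero (suc zero) = sym ab
    adjacency zero (suc (suc zero)) = sym ac
    adjacency zero (suc (suc (suc zero))) = sym ad
    adjacency (suc zero) zero = sym (A-sym ab)
    adjacency (suc zero) (suc zero) = loop-free b
    adjacency (suc zero) (suc (suc zero)) = sym bc
    adjacency (suc zero) (suc (suc (suc zero))) = sym bd
    adjacency (suc (suc zero)) zero = sym (A-sym ac)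
    adjacency (suc (suc zero)) (suc zero) = sym (A-sym bc)
    adjacency (suc (suc zero)) (suc (suc zero)) = loop-free c
    adjacency (suc (suc zero)) (suc (suc (suc zero))) = sym cd
    adjacency (suc (suc (suc zero))) zero = sym (trans (adj-sym G d a) ad)
    adjacency (suc (suc (suc zero))) (suc zero) = sym (A-sym bd)
    adjacency (suc (suc (suc zero))) (suc (suc zero)) = sym (A-sym cd)
    adjacency (suc (suc (suc zero))) (suc (suc (suc zero))) = loop-free d

  data Prunable (W : List V) (v : V) : Set where
    isolated : (∀ y → elem y W ≡ true → A v y ≡ false) → Prunable W v
    pendant  : ∀ u → elem u W ≡ true → A v u ≡ true →
               (∀ y → elem y W ≡ true → y ≢ u → A v y ≡ false) → Prunable W v
    twin     : ∀ w → elem w W ≡ true → A v w ≡ true →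
               (∀ y → elem y W ≡ true → y ≢ v → y ≢ w → A v y ≡ A w y) → Prunable W v

  private
    ∧₃-true : ∀ {a b c} → a ≡ true → b ≡ true → c ≡ true → a ∧ b ∧ c ≡ true
    ∧₃-true refl refl refl = refl

    ∧₃-parts : ∀ {a b c} → a ∧ b ∧ c ≡ true → a ≡ true × b ≡ true × c ≡ true
    ∧₃-parts {true} {true} {true} _ = refl , refl , refl

    not-true : ∀ {a} → not a ≡ true → a ≡ false
    not-true {false} _ = refl

  module GreedyWalk (W : List V) (inS : ∀ y → elem y W ≡ true → S y ≡ true) where
    InW : List V → Set
    InW = All (λ y → elem y W ≡ true)

    InW⇒AllIn : ∀ {ws} → InW ws → AllIn ws
    InW⇒AllIn [] = []
    InW⇒AllIn {y ∷ _} (p ∷ ps) = inS y p ∷ InW⇒AllIn ps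

    Walk : Set
    Walk = Σ (List V) λ ws → LocallyInduced ws × InW ws

    Longer : ℕ → Set
    Longer k = Σ Walk λ w → length (proj₁ w) ≡ suc k

    -- replacing the head v of v u r by a common neighbour w of v and u keeps the walk
    -- locally induced (a neighbour of w on r would give a diamond)
    swap-head : ∀ v u w r → LocallyInduced (v ∷ u ∷ r) → InW r → A v w ≡ true → A u w ≡ true → w ≢ u →
                S w ≡ true → S u ≡ true → S v ≡ true → LocallyInduced (w ∷ u ∷ r)
    swap-head v u w [] li _ avw auw wu _ _ _ = A-sym auw
    swap-head v u w (x₂ ∷ r) (avu , vx₂ , avx₂ , li') (mx₂ ∷ _) avw auw wu sw su sv = A-sym auw , wx₂ , awx₂ , li'
      where
      wx₂ : w ≢ x₂
      wx₂ refl = true≢false avw avx₂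
      awx₂ : A w x₂ ≡ false
      awx₂ with A w x₂ in e
      ... | false = refl
      ... | true = ⊥-elim (no-diamond x₂ u w v (inS x₂ mx₂) su sw sv
                             (A-sym (LocallyInduced-head u x₂ r li')) (A-sym e) auw (A-sym avu) (A-sym avw)
                             (trans (adj-sym G x₂ v) avx₂) (λ q → vx₂ (sym q)))

    twin-or-longer : ∀ v u r → LocallyInduced (v ∷ u ∷ r) → elem v W ≡ true → elem u W ≡ true → InW r →
                     (∀ y → elem y W ≡ true → A v y ≡ true → y ≢ u → A u y ≡ true) →
                     ∀ w → elem w W ≡ true → A v w ≡ true → w ≢ u →
                     Prunable W v ⊎ Longer (length (v ∷ u ∷ r))
    twin-or-longer v u r li mv mu mr seen-by-u w mw avw wu
      with search (λ z → A w z ∧ not (A v z) ∧ not (eqV z v)) W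
    ... | inj₂ none = inj₁ (twin w mw avw same)
      where
      auw : A u w ≡ true
      auw = seen-by-u w mw avw wu
      same : ∀ y → elem y W ≡ true → y ≢ v → y ≢ w → A v y ≡ A w y
      same y my yv yw = bool-⇔ v⇒w w⇒v
        where
        v⇒w : A v y ≡ true → A w y ≡ true
        v⇒w avy with y F.≟ u
        ... | yes refl = A-sym auw
        ... | no yu with A w y in awy
        ...   | true = refl
        ...   | false = ⊥-elim (no-diamond w u v y (inS w mw) (inS u mu) (inS v mv) (inS y my)
                          (A-sym auw) (A-sym avw) (A-sym (LocallyInduced-head v u r li))
                          (seen-by-u y my avy yu) avy awy (λ q → yw (sym q)))
        w⇒v : A w y ≡ true → A v y ≡ true
        w⇒v awy with A v y in avy
        ... | true = refl
        ... | false = ⊥-elim (true≢false (∧₃-true awy (cong not avy) (cong not (≟-neq (y F.≟ v) yv)))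
                                         (none y my))
    ... | inj₁ (z , mz , pz) with ∧₃-parts {A w z} pz
    ...   | (awz , nvz , nzv) =
      inj₂ ((z ∷ w ∷ u ∷ r , (A-sym awz , zu , azu , swap-head v u w r li mr avw auw wu (inS w mw) (inS u mu) (inS v mv)) ,
             (mz ∷ mw ∷ mu ∷ mr)) , refl)
      where
      auw : A u w ≡ true
      auw = seen-by-u w mw avw wu
      zu : z ≢ u
      zu refl = true≢false (LocallyInduced-head v z r li) (not-true nvz)
      azu : A z u ≡ false
      azu with A u z in e
      ... | true = ⊥-elim (no-diamond v u w z (inS v mv) (inS u mu) (inS w mw) (inS z mz)
                             (LocallyInduced-head v u r li) avw auw e awz (not-true nvz)
                             (λ q → ≟-false (z F.≟ v) (not-true nzv) (sym q)))
      ... | false = trans (adj-sym G z u) e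

    walk-step : ∀ v r → LocallyInduced (v ∷ r) → InW (v ∷ r) → Prunable W v ⊎ Longer (length (v ∷ r))
    walk-step v [] li (mv ∷ []) with search (λ y → A v y) W
    ... | inj₁ (y , my , ay) = inj₂ ((y ∷ v ∷ [] , A-sym ay , (my ∷ mv ∷ [])) , refl)
    ... | inj₂ h = inj₁ (isolated h)
    walk-step v (u ∷ r) li (mv ∷ mu ∷ mr) with search (λ y → A v y ∧ not (eqV y u) ∧ not (A u y)) W
    ... | inj₁ (y , my , py) with ∧₃-parts {A v y} py
    ...   | (ay , ny , nuy) = inj₂ ((y ∷ v ∷ u ∷ r ,
              (A-sym ay , ≟-false (y F.≟ u) (not-true ny) , trans (adj-sym G y u) (not-true nuy) , li) ,
              (my ∷ mv ∷ mu ∷ mr)) , refl)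
    walk-step v (u ∷ r) li (mv ∷ mu ∷ mr) | inj₂ none with search (λ w → A v w ∧ not (eqV w u)) W
    ... | inj₂ only-u = inj₁ (pendant u mu (LocallyInduced-head v u r li) no-other)
      where
      no-other : ∀ y → elem y W ≡ true → y ≢ u → A v y ≡ false
      no-other y my yu with A v y in avy
      ... | false = refl
      ... | true = ⊥-elim (true≢false (cong not (≟-neq (y F.≟ u) yu)) (∧-conicalʳ-false (only-u y my) avy))
        where
        ∧-conicalʳ-false : ∀ {a b} → a ∧ b ≡ false → a ≡ true → b ≡ false
        ∧-conicalʳ-false {true} e _ = e
    ... | inj₁ (w , mw , pw) =
      twin-or-longer v u r li mv mu mr seen-by-u w mw (∧-conicalˡ _ _ pw)
                     (≟-false (w F.≟ u) (not-true (∧-conicalʳ (A v w) _ pw)))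
      where
      seen-by-u : ∀ y → elem y W ≡ true → A v y ≡ true → y ≢ u → A u y ≡ true
      seen-by-u y my avy yu with A u y in auy
      ... | true = refl
      ... | false = ⊥-elim (true≢false (∧₃-true avy (cong not (≟-neq (y F.≟ u) yu)) (cong not auy)) (none y my))

    -- a walk with more than n vertices is impossible, so fuel n suffices
    walk : ∀ fuel v r → LocallyInduced (v ∷ r) → InW (v ∷ r) → n < length (v ∷ r) + fuel →
           Σ V λ v → elem v W ≡ true × Prunable W v
    walk zero v r li m b =
      ⊥-elim (ℕP.<-irrefl refl (ℕP.<-≤-trans b (subst (_≤ n) (sym (ℕP.+-identityʳ _))
                                                (induced-length (v ∷ r) li (InW⇒AllIn m)))))
    walk (suc fuel) v r li (mv ∷ mr) b with walk-step v r li (mv ∷ mr)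
    ... | inj₁ p = v , mv , p
    ... | inj₂ ((v' ∷ r' , li' , m') , eq) =
      walk fuel v' r' li' m' (subst (n <_) (trans (ℕP.+-suc (length (v ∷ r)) fuel) (cong (_+ fuel) (sym eq))) b)

  find-prunable : ∀ W → (∀ y → elem y W ≡ true → S y ≡ true) → ∀ s → elem s W ≡ true →
                  Σ V λ v → elem v W ≡ true × Prunable W v
  find-prunable W inS s m = GreedyWalk.walk W inS n s [] tt (m ∷ []) (s≤s ℕP.≤-refl)

-- Labels 0 and 1 are live,
-- label 2 is inert.  To add a vertex v next to a
-- member w (leaf w ℓ inside context C) we substitute
--     rn t r (jn ℓ t (un (leaf w ℓ) (leaf v t)))          (t the live label ≠ ℓ)
-- for the leaf: v becomes adjacent to w and then behaves like a hole vertex of label r.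
-- For a twin r = ℓ (v sees what w sees), for a pendant vertex r = inert (v sees nothing).

inert : Fin 3
inert = suc (suc zero)

spare : Fin 3 → Fin 3
spare zero = suc zero
spare (suc _) = zero

spare-≢ : ∀ ℓ → ℓ ≢ inert → spare ℓ ≢ ℓ
spare-≢ zero _ ()
spare-≢ (suc zero) _ ()
spare-≢ (suc (suc zero)) h _ = h refl

spare-live : ∀ ℓ → spare ℓ ≢ inert
spare-live zero ()
spare-live (suc _) ()

module PruningSteps {n : ℕ} (G : Graph n) where
  open Substitution {n} {Fin 3} F._≟_ zero public
  open Inert inert public
  open Adjacency G

  Generates : Expr → Set
  Generates e = WellFormed e × Uses-z-inertly e × (∀ x y → mem e x ≡ true → mem e y ≡ true → edge e x y ≡ A x y)

  Extension : Expr → V → Set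
  Extension e v = Σ Expr λ e' → Generates e' × (∀ x → mem e' x ≡ mem e x ∨ eqV v x)

  module AddNextTo (C : Context) (w v : V) (ℓ r : Fin 3) (ℓ-live : ℓ ≢ inert)
                   (gen : Generates (plug C (leaf w ℓ))) (v∉e : mem (plug C (leaf w ℓ)) v ≡ false)
                   (v~w : A v w ≡ true)
                   (v-sees : ∀ y → mem (plug C (leaf w ℓ)) y ≡ true → y ≢ w → holeEdge C r y ≡ A v y)
                   (v-no-loop : holeJoin C r r ≡ false) where
    e : Expr
    e = plug C (leaf w ℓ)
    t : Fin 3
    t = spare ℓ
    ℓ≢t : ℓ ≢ t
    ℓ≢t q = spare-≢ ℓ ℓ-live (sym q)
    gadget : Expr
    gadget = rn t r (jn ℓ t ℓ≢t (un (leaf w ℓ) (leaf v t)))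
    e' : Expr
    e' = plug C gadget

    wf-e = proj₁ gen
    inert-e = proj₁ (proj₂ gen)
    edges-e = proj₂ (proj₂ gen)
    inert-C : CtxInert C
    inert-C = proj₁ (inert-split C (leaf w ℓ) inert-e)

    w∈e : mem e w ≡ true
    w∈e = mem-plug-in C (leaf w ℓ) w (eqV-refl w)
    v≢w : v ≢ w
    v≢w refl = true≢false w∈e v∉e
    w≠v : eqV w v ≡ false
    w≠v = ≟-neq (w F.≟ v) (λ q → v≢w (sym q))

    lab-w : lab gadget w ≡ ℓ
    lab-w rewrite eqV-refl w | ≟-neq (ℓ F.≟ t) ℓ≢t = refl
    lab-v : lab gadget v ≡ r
    lab-v rewrite w≠v | ≟-refl (t F.≟ t) = refl

    apart : ApartFrom C (leaf w ℓ)
    apart = wellFormed-apart C (leaf w ℓ) wf-e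
    apart' : ApartFrom C gadget
    apart' x m with w F.≟ x
    ... | yes refl = apart w (eqV-refl w)
    ... | no _ with ≟-true (v F.≟ x) m
    ...   | refl = ∨-conicalˡ _ _ (trans (sym (mem-plug C (leaf w ℓ) v)) v∉e)

    wf' : WellFormed e'
    wf' = wellFormed-plug C (leaf w ℓ) gadget wf-e (tt , tt , dj) new
      where
      dj : Disj (leaf w ℓ) (leaf v t)
      dj x m with ≟-true (w F.≟ x) m
      ... | refl = ≟-neq (v F.≟ w) v≢w
      new : ∀ x → mem gadget x ≡ true → mem (leaf w ℓ) x ≡ true ⊎ mem e x ≡ false
      new x m with w F.≟ x
      ... | yes refl = inj₁ refl
      ... | no _ with ≟-true (v F.≟ x) m
      ...   | refl = inj₂ v∉e

    inert' : Uses-z-inertly e'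
    inert' = inert-plug C gadget inert-C (spare-live ℓ , ℓ-live , spare-live ℓ , ℓ-live , spare-live ℓ)

    mem' : ∀ x → mem e' x ≡ mem e x ∨ eqV v x
    mem' x rewrite mem-plug C gadget x | mem-plug C (leaf w ℓ) x = sym (∨-assoc (ctxMem C x) (eqV w x) (eqV v x))

    outside-gadget : ∀ x → x ≢ w → x ≢ v → mem gadget x ≡ false
    outside-gadget x xw xv = ∨-false (≟-neq (w F.≟ x) (λ q → xw (sym q))) (≟-neq (v F.≟ x) (λ q → xv (sym q)))

    old-member : ∀ x → x ≢ w → x ≢ v → mem e' x ≡ true → mem e x ≡ true
    old-member x xw xv m = trans (mem-plug-out C (leaf w ℓ) x (≟-neq (w F.≟ x) (λ q → xw (sym q))))
                             (trans (sym (mem-plug-out C gadget x (outside-gadget x xw xv))) m)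

    edge-wv : edge gadget w v ≡ true
    edge-wv rewrite eqV-refl w | w≠v | ≟-refl (v F.≟ v) | ≟-refl (ℓ F.≟ ℓ) | ≟-refl (t F.≟ t) = refl

    edges-mixed : ∀ x y → (x ≡ w ⊎ x ≡ v) → y ≢ w → y ≢ v → mem e' y ≡ true → edge e' x y ≡ A x y
    edges-mixed x y (inj₁ refl) yw yv my =
      trans (edge-plug-mixed C gadget apart' w y (∨-inl (eqV-refl w)) (outside-gadget y yw yv))
        (trans (cong (λ l → holeEdge C l y) lab-w)
          (trans (sym (edge-plug-mixed C (leaf w ℓ) apart w y (eqV-refl w) (≟-neq (w F.≟ y) (λ q → yw (sym q)))))
            (edges-e w y w∈e (old-member y yw yv my))))
    edges-mixed x y (inj₂ refl) yw yv my =
      trans (edge-plug-mixed C gadget apart' v y (∨-inr (eqV w v) (eqV-refl v)) (outside-gadget y yw yv))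
        (trans (cong (λ l → holeEdge C l y) lab-v) (v-sees y (old-member y yw yv my) yw))

    edges-inside : ∀ x y → (x ≡ w ⊎ x ≡ v) → (y ≡ w ⊎ y ≡ v) → edge e' x y ≡ A x y
    edges-inside x y xin yin = trans (edge-plug-inside C gadget apart' x y (in-gadget xin) (in-gadget yin)) (by-cases xin yin)
      where
      in-gadget : ∀ {x} → (x ≡ w ⊎ x ≡ v) → mem gadget x ≡ true
      in-gadget (inj₁ refl) = ∨-inl (eqV-refl w)
      in-gadget (inj₂ refl) = ∨-inr (eqV w v) (eqV-refl v)
      by-cases : ∀ {x y} → (x ≡ w ⊎ x ≡ v) → (y ≡ w ⊎ y ≡ v) →
                 edge gadget x y ∨ holeJoin C (lab gadget x) (lab gadget y) ≡ A x y
      by-cases (inj₁ refl) (inj₁ refl) rewrite edge-irrefl gadget w | lab-w | holeJoin-irrefl C w ℓ wf-e = sym (irrefl G w)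
      by-cases (inj₂ refl) (inj₂ refl) rewrite edge-irrefl gadget v | lab-v | v-no-loop = sym (irrefl G v)
      by-cases (inj₁ refl) (inj₂ refl) rewrite edge-wv = sym (A-sym v~w)
      by-cases (inj₂ refl) (inj₁ refl) rewrite edge-sym gadget v w | edge-wv = sym v~w

    edges' : ∀ x y → mem e' x ≡ true → mem e' y ≡ true → edge e' x y ≡ A x y
    edges' x y mx my with x F.≟ w | x F.≟ v | y F.≟ w | y F.≟ v
    ... | yes p | _ | yes q | _ = edges-inside x y (inj₁ p) (inj₁ q)
    ... | yes p | _ | no _ | yes q = edges-inside x y (inj₁ p) (inj₂ q)
    ... | no _ | yes p | yes q | _ = edges-inside x y (inj₂ p) (inj₁ q)
    ... | no _ | yes p | no _ | yes q = edges-inside x y (inj₂ p) (inj₂ q)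
    ... | yes p | _ | no yw | no yv = edges-mixed x y (inj₁ p) yw yv my
    ... | no _ | yes p | no yw | no yv = edges-mixed x y (inj₂ p) yw yv my
    ... | no xw | no xv | yes q | _ = trans (edge-sym e' x y) (trans (edges-mixed y x (inj₁ q) xw xv mx) (adj-sym G y x))
    ... | no xw | no xv | no _ | yes q = trans (edge-sym e' x y) (trans (edges-mixed y x (inj₂ q) xw xv mx) (adj-sym G y x))
    ... | no xw | no xv | no yw | no yv =
      trans (edge-plug-outside C gadget x y (outside-gadget x xw xv) (outside-gadget y yw yv))
        (trans (sym (edge-plug-outside C (leaf w ℓ) x y (≟-neq (w F.≟ x) (λ q → xw (sym q)))
                                                         (≟-neq (w F.≟ y) (λ q → yw (sym q)))))
          (edges-e x y (old-member x xw xv mx) (old-member y yw yv my)))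

    extension : Extension e v
    extension = e' , (wf' , inert' , edges') , mem'

  add-twin : ∀ e w v → Generates e → mem e w ≡ true → mem e v ≡ false → A v w ≡ true →
             (∀ y → mem e y ≡ true → y ≢ w → A v y ≡ A w y) → Extension e v
  add-twin e w v gen w∈e v∉e v~w same with decompose e w w∈e
  ... | C , ℓ , refl = AddNextTo.extension C w v ℓ ℓ ℓ-live gen v∉e v~w v-sees (holeJoin-irrefl C w ℓ (proj₁ gen))
    where
    ℓ-live : ℓ ≢ inert
    ℓ-live = proj₂ (inert-split C (leaf w ℓ) (proj₁ (proj₂ gen)))
    apart : ApartFrom C (leaf w ℓ)
    apart = wellFormed-apart C (leaf w ℓ) (proj₁ gen)
    v-sees : ∀ y → mem (plug C (leaf w ℓ)) y ≡ true → y ≢ w → holeEdge C ℓ y ≡ A v y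
    v-sees y my yw = trans (sym (edge-plug-mixed C (leaf w ℓ) apart w y (eqV-refl w) (≟-neq (w F.≟ y) (λ q → yw (sym q)))))
                           (trans (proj₂ (proj₂ gen) w y w∈e my) (sym (same y my yw)))

  add-pendant : ∀ e u v → Generates e → mem e u ≡ true → mem e v ≡ false → A v u ≡ true →
                (∀ y → mem e y ≡ true → y ≢ u → A v y ≡ false) → Extension e v
  add-pendant e u v gen u∈e v∉e v~u only-u with decompose e u u∈e
  ... | C , ℓ , refl =
    AddNextTo.extension C u v ℓ inert ℓ-live gen v∉e v~u v-sees (holeJoin-z C inert inert-C)
    where
    inert-C = proj₁ (inert-split C (leaf u ℓ) (proj₁ (proj₂ gen)))
    ℓ-live : ℓ ≢ inert
    ℓ-live = proj₂ (inert-split C (leaf u ℓ) (proj₁ (proj₂ gen)))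
    v-sees : ∀ y → mem (plug C (leaf u ℓ)) y ≡ true → y ≢ u → holeEdge C inert y ≡ A v y
    v-sees y my yu = trans (holeEdge-z C y inert-C) (sym (only-u y my yu))

  singleton : ∀ v → Generates (leaf v zero)
  singleton v = tt , (λ ()) , (λ x y mx my → trans (sym (irrefl G x))
                  (cong (A x) (trans (sym (≟-true (v F.≟ x) mx)) (≟-true (v F.≟ y) my))))

-- By pruning W and adding the
-- pruned vertex back, every list W of vertices of S is covered by a list of pairwise
-- disjoint and non-adjacent pieces: an isolated vertex is a new piece; a pendant or twin
-- vertex joins the piece of its neighbour (all its neighbours lie in that piece).

module Pieces {n : ℕ} (G : Graph n) (S : Fin n → Bool)
              (diamondFree : FreeOn S G diamondAdj) (chordal : ChordalOn S G) where
  open PruningSteps G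
  open Adjacency G
  open VertexLists {n} using (elem; keep; elem-keep⁻; elem-keep⁺; keep-shorter)
  open Pruning G S diamondFree chordal using (Prunable; isolated; pendant; twin; find-prunable)

  record Piece : Set where
    constructor piece
    field
      expr : Expr
      root : V
      generates : Generates expr
      connected : ∀ y → mem expr y ≡ true → ConnOn S G root y
  open Piece public

  inPieces : List Piece → V → Bool
  inPieces [] y = false
  inPieces (P ∷ Ps) y = mem (expr P) y ∨ inPieces Ps y

  Separated : List Piece → Set
  Separated [] = ⊤
  Separated (P ∷ Ps) = Separated Ps × (∀ y → mem (expr P) y ≡ true → inPieces Ps y ≡ false) ×
                       (∀ x y → mem (expr P) x ≡ true → inPieces Ps y ≡ true → A x y ≡ false)

  Grow : List Piece → V → V → Set
  Grow Ps w v = ∀ P → (∀ y → mem (expr P) y ≡ true → inPieces Ps y ≡ true) → mem (expr P) w ≡ true →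
                mem (expr P) v ≡ false → Σ Piece λ P' → ∀ x → mem (expr P') x ≡ mem (expr P) x ∨ eqV v x

  grow-pieces : ∀ Ps → Separated Ps → ∀ w v → inPieces Ps w ≡ true → inPieces Ps v ≡ false →
                (∀ y → inPieces Ps y ≡ true → A v y ≡ true → y ≡ w ⊎ A w y ≡ true) → Grow Ps w v →
                Σ (List Piece) λ Ps' → Separated Ps' × (∀ x → inPieces Ps' x ≡ inPieces Ps x ∨ eqV v x)
  grow-pieces [] _ w v () _ _ _
  grow-pieces (P ∷ Ps) (sep , disj , nonadj) w v w∈ v∉ near grow with mem (expr P) w in w∈P
  ... | true with grow P (λ y m → ∨-inl m) w∈P (∨-conicalˡ _ _ v∉)
  ...   | P' , mem' = P' ∷ Ps , (sep , disj' , nonadj') , mem''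
    where
    disj' : ∀ y → mem (expr P') y ≡ true → inPieces Ps y ≡ false
    disj' y m with ∨-cases (mem (expr P) y) (trans (sym (mem' y)) m)
    ... | inj₁ p = disj y p
    ... | inj₂ p with ≟-true (v F.≟ y) p
    ...   | refl = ∨-conicalʳ _ _ v∉
    nonadj' : ∀ x y → mem (expr P') x ≡ true → inPieces Ps y ≡ true → A x y ≡ false
    nonadj' x y m my with ∨-cases (mem (expr P) x) (trans (sym (mem' x)) m)
    ... | inj₁ p = nonadj x y p my
    ... | inj₂ p with ≟-true (v F.≟ x) p
    ...   | refl with A v y in avy
    ...     | false = refl
    ...     | true with near y (∨-inr (mem (expr P) y) my) avy
    ...       | inj₁ refl = ⊥-elim (true≢false my (disj y w∈P))
    ...       | inj₂ awy = ⊥-elim (true≢false awy (nonadj w y w∈P my))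
    mem'' : ∀ x → inPieces (P' ∷ Ps) x ≡ inPieces (P ∷ Ps) x ∨ eqV v x
    mem'' x rewrite mem' x = agree-sound 3 (λ a b c → (a ∨ b) ∨ c) (λ a b c → (a ∨ c) ∨ b) tt
                                          (mem (expr P) x) (eqV v x) (inPieces Ps x)
  grow-pieces (P ∷ Ps) (sep , disj , nonadj) w v w∈ v∉ near grow | false
    with grow-pieces Ps sep w v w∈ (∨-conicalʳ _ _ v∉) (λ y m → near y (∨-inr (mem (expr P) y) m))
                     (λ P₁ sub → grow P₁ (λ y m → ∨-inr (mem (expr P) y) (sub y m)))
  ... | Ps' , sep' , mem' = P ∷ Ps' , (sep' , disj' , nonadj') , mem''
    where
    v∉P : mem (expr P) v ≡ false
    v∉P = ∨-conicalˡ _ _ v∉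
    disj' : ∀ y → mem (expr P) y ≡ true → inPieces Ps' y ≡ false
    disj' y m rewrite mem' y | disj y m = ≟-neq (v F.≟ y) (λ { refl → true≢false m v∉P })
    nonadj' : ∀ x y → mem (expr P) x ≡ true → inPieces Ps' y ≡ true → A x y ≡ false
    nonadj' x y m my with ∨-cases (inPieces Ps y) (trans (sym (mem' y)) my)
    ... | inj₁ p = nonadj x y m p
    ... | inj₂ p with ≟-true (v F.≟ y) p
    ...   | refl with A v x in avx
    ...     | true with near x (∨-inl m) avx
    ...       | inj₁ refl = ⊥-elim (true≢false m w∈P)
    ...       | inj₂ awx = ⊥-elim (true≢false (A-sym awx) (nonadj x w m w∈))
    nonadj' x y m my | inj₂ p | refl | false = trans (adj-sym G x v) avx
    mem'' : ∀ x → inPieces (P ∷ Ps') x ≡ inPieces (P ∷ Ps) x ∨ eqV v x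
    mem'' x rewrite mem' x = sym (∨-assoc (mem (expr P) x) (inPieces Ps x) (eqV v x))

  Cover : List V → Set
  Cover W = Σ (List Piece) λ Ps → Separated Ps × (∀ y → inPieces Ps y ≡ elem y W)

  differs : V → V → Bool
  differs v y = not (eqV v y)

  without : V → List V → List V
  without v = keep (differs v)

  module AddBack (W : List V) (inS : ∀ y → elem y W ≡ true → S y ≡ true) (v : V) (v∈W : elem v W ≡ true)
                 (Ps : List Piece) (sep : Separated Ps) (covers : ∀ y → inPieces Ps y ≡ elem y (without v W)) where
    in-W : ∀ y → inPieces Ps y ≡ true → elem y W ≡ true
    in-W y m = proj₁ (elem-keep⁻ (differs v) W y (trans (sym (covers y)) m))

    not-v : ∀ y → inPieces Ps y ≡ true → y ≢ v
    not-v y m refl = true≢false (proj₂ (elem-keep⁻ (differs v) W y (trans (sym (covers y)) m))) (cong not (eqV-refl y))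

    v∉Ps : inPieces Ps v ≡ false
    v∉Ps with inPieces Ps v in e
    ... | false = refl
    ... | true = ⊥-elim (not-v v e refl)

    other∈Ps : ∀ y → elem y W ≡ true → y ≢ v → inPieces Ps y ≡ true
    other∈Ps y m y≢v = trans (covers y) (elem-keep⁺ (differs v) W y m (cong not (≟-neq (v F.≟ y) (λ q → y≢v (sym q)))))

    covers-W : ∀ y → inPieces Ps y ∨ eqV v y ≡ elem y W
    covers-W y = bool-⇔ to from
      where
      to : inPieces Ps y ∨ eqV v y ≡ true → elem y W ≡ true
      to m with ∨-cases (inPieces Ps y) m
      ... | inj₁ q = in-W y q
      ... | inj₂ q with ≟-true (v F.≟ y) q
      ...   | refl = v∈W
      from : elem y W ≡ true → inPieces Ps y ∨ eqV v y ≡ true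
      from m with v F.≟ y
      ... | yes refl = ∨-inr (inPieces Ps v) refl
      ... | no v≢y = ∨-inl (other∈Ps y m (λ q → v≢y (sym q)))

    new-piece : (∀ y → elem y W ≡ true → A v y ≡ false) → Cover W
    new-piece isolated-v = piece (leaf v zero) v (singleton v) conn ∷ Ps , (sep , disj , nonadj) , cov
      where
      conn : ∀ y → mem (leaf v zero) y ≡ true → ConnOn S G v y
      conn y m with ≟-true (v F.≟ y) m
      ... | refl = here (inS v v∈W)
      disj : ∀ y → eqV v y ≡ true → inPieces Ps y ≡ false
      disj y m with ≟-true (v F.≟ y) m
      ... | refl = v∉Ps
      nonadj : ∀ x y → eqV v x ≡ true → inPieces Ps y ≡ true → A x y ≡ false
      nonadj x y m my with ≟-true (v F.≟ x) m
      ... | refl = isolated-v y (in-W y my)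
      cov : ∀ y → eqV v y ∨ inPieces Ps y ≡ elem y W
      cov y = trans (∨-comm (eqV v y) (inPieces Ps y)) (covers-W y)

    next-to : ∀ w → elem w W ≡ true → A v w ≡ true →
              (∀ y → inPieces Ps y ≡ true → A v y ≡ true → y ≡ w ⊎ A w y ≡ true) →
              (∀ e → Generates e → (∀ y → mem e y ≡ true → inPieces Ps y ≡ true) →
                     mem e w ≡ true → mem e v ≡ false → Extension e v) → Cover W
    next-to w w∈W v~w near extend with grow-pieces Ps sep w v w∈Ps v∉Ps near grow
      where
      w∈Ps : inPieces Ps w ≡ true
      w∈Ps = other∈Ps w w∈W (λ q → A-neq v~w (sym q))
      grow : Grow Ps w v
      grow P sub w∈P v∉P with extend (expr P) (generates P) sub w∈P v∉P
      ... | e' , gen' , mem' = piece e' (root P) gen' conn , mem'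
        where
        conn : ∀ y → mem e' y ≡ true → ConnOn S G (root P) y
        conn y m with ∨-cases (mem (expr P) y) (trans (sym (mem' y)) m)
        ... | inj₁ q = connected P y q
        ... | inj₂ q with ≟-true (v F.≟ y) q
        ...   | refl = step (connected P w w∈P) (inS v v∈W) (A-sym v~w)
    ... | Ps' , sep' , mem' = Ps' , sep' , λ y → trans (mem' y) (covers-W y)

    add-back : Prunable W v → Cover W
    add-back (isolated h) = new-piece h
    add-back (pendant u u∈W v~u only-u) =
      next-to u u∈W v~u near
        (λ e gen sub u∈e v∉e → add-pendant e u v gen u∈e v∉e v~u (λ y m yu → only-u y (in-W y (sub y m)) yu))
      where
      near : ∀ y → inPieces Ps y ≡ true → A v y ≡ true → y ≡ u ⊎ A u y ≡ true
      near y my avy with y F.≟ u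
      ... | yes q = inj₁ q
      ... | no yu = ⊥-elim (true≢false avy (only-u y (in-W y my) yu))
    add-back (twin w w∈W v~w same) =
      next-to w w∈W v~w near
        (λ e gen sub w∈e v∉e → add-twin e w v gen w∈e v∉e v~w
                                  (λ y m yw → same y (in-W y (sub y m)) (not-v y (sub y m)) yw))
      where
      near : ∀ y → inPieces Ps y ≡ true → A v y ≡ true → y ≡ w ⊎ A w y ≡ true
      near y my avy with y F.≟ w
      ... | yes q = inj₁ q
      ... | no yw = inj₂ (trans (sym (same y (in-W y my) (not-v y my) yw)) avy)

  cover : ∀ fuel W → length W ≤ fuel → (∀ y → elem y W ≡ true → S y ≡ true) → Cover W
  cover _ [] _ _ = [] , tt , λ y → refl
  cover (suc fuel) (s ∷ r) (s≤s len) inS with find-prunable (s ∷ r) inS s (∨-inl (eqV-refl s))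
  ... | v , v∈W , how with cover fuel (without v (s ∷ r)) shorter (λ y m → inS y (proj₁ (elem-keep⁻ (differs v) (s ∷ r) y m)))
    where
    shorter : length (without v (s ∷ r)) ≤ fuel
    shorter = ℕP.≤-pred (ℕP.≤-trans (keep-shorter (differs v) (s ∷ r) v v∈W (cong not (eqV-refl v))) (s≤s len))
  ... | Ps , sep , covers = AddBack.add-back (s ∷ r) inS v v∈W Ps sep covers how

-- A label ℓ ∈ Fin 3 with a bit b is encoded as mark ℓ b ∈ {0,…,5} ⊆ Fin 8.
-- Given a bit mk y for every vertex, a 3-label expression becomes an 8-label one with the
-- same graph whose labels carry the bits: a join of i and j becomes the four joins of
-- (i, b) and (j, c), a renaming of i to j the two renamings that keep the bit.

mark : Fin 3 → Bool → Fin 8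
mark zero false = zero
mark (suc zero) false = suc zero
mark (suc (suc zero)) false = suc (suc zero)
mark zero true = suc (suc (suc zero))
mark (suc zero) true = suc (suc (suc (suc zero)))
mark (suc (suc zero)) true = suc (suc (suc (suc (suc zero))))

private
  unmark : Fin 8 → Fin 3 × Bool
  unmark (suc (suc (suc zero))) = zero , true
  unmark (suc (suc (suc (suc zero)))) = suc zero , true
  unmark (suc (suc (suc (suc (suc zero))))) = suc (suc zero) , true
  unmark (suc zero) = suc zero , false
  unmark (suc (suc zero)) = suc (suc zero) , false
  unmark _ = zero , false

  unmark-mark : ∀ ℓ b → unmark (mark ℓ b) ≡ (ℓ , b)
  unmark-mark zero false = refl
  unmark-mark (suc zero) false = refl
  unmark-mark (suc (suc zero)) false = refl
  unmark-mark zero true = refl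
  unmark-mark (suc zero) true = refl
  unmark-mark (suc (suc zero)) true = refl

mark-injective : ∀ {a b c d} → mark a b ≡ mark c d → a ≡ c × b ≡ d
mark-injective {a} {b} {c} {d} e with trans (sym (unmark-mark a b)) (trans (cong unmark e) (unmark-mark c d))
... | refl = refl , refl

mark-≟ : ∀ a b c d → ⌊ mark a b F.≟ mark c d ⌋ ≡ ⌊ a F.≟ c ⌋ ∧ ⌊ b B.≟ d ⌋
mark-≟ a b c d with a F.≟ c | b B.≟ d
... | yes refl | yes refl = ≟-refl (mark a b F.≟ mark a b)
... | yes refl | no b≢d = ≟-neq (mark a b F.≟ mark a d) (λ e → b≢d (proj₂ (mark-injective e)))
... | no a≢c | _ = ≟-neq (mark a b F.≟ mark c d) (λ e → a≢c (proj₁ (mark-injective e)))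

mark-≢ : ∀ {a c} b d → a ≢ c → mark a b ≢ mark c d
mark-≢ b d a≢c e = a≢c (proj₁ (mark-injective e))

module Marking {n : ℕ} (mk : Fin n → Bool) where
  module E3 = Expressions {n} {Fin 3} F._≟_ zero
  module E8 = Expressions {n} {Fin 8} F._≟_ zero

  marked : E3.Expr → E8.Expr
  marked E3.emp = E8.emp
  marked (E3.leaf v ℓ) = E8.leaf v (mark ℓ (mk v))
  marked (E3.un e f) = E8.un (marked e) (marked f)
  marked (E3.jn i j p e) =
    E8.jn (mark i false) (mark j false) (mark-≢ false false p)
      (E8.jn (mark i false) (mark j true) (mark-≢ false true p)
        (E8.jn (mark i true) (mark j false) (mark-≢ true false p)
          (E8.jn (mark i true) (mark j true) (mark-≢ true true p) (marked e))))
  marked (E3.rn i j e) = E8.rn (mark i false) (mark j false) (E8.rn (mark i true) (mark j true) (marked e))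

  marked-mem : ∀ e y → E8.mem (marked e) y ≡ E3.mem e y
  marked-mem E3.emp y = refl
  marked-mem (E3.leaf v ℓ) y = refl
  marked-mem (E3.un e f) y rewrite marked-mem e y | marked-mem f y = refl
  marked-mem (E3.jn i j p e) y = marked-mem e y
  marked-mem (E3.rn i j e) y = marked-mem e y

  mark-rename : ∀ i j ℓ m →
    (let l₁ = if ⌊ mark ℓ m F.≟ mark i true ⌋ then mark j true else mark ℓ m
     in if ⌊ l₁ F.≟ mark i false ⌋ then mark j false else l₁) ≡ mark (if ⌊ ℓ F.≟ i ⌋ then j else ℓ) m
  mark-rename i j ℓ m with ℓ F.≟ i | m
  ... | yes refl | true rewrite ≟-refl (mark ℓ true F.≟ mark ℓ true) | mark-≟ j true ℓ false
                              | ∧-zeroʳ ⌊ j F.≟ ℓ ⌋ = refl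
  ... | yes refl | false rewrite mark-≟ ℓ false ℓ true | ∧-zeroʳ ⌊ ℓ F.≟ ℓ ⌋
                               | ≟-refl (mark ℓ false F.≟ mark ℓ false) = refl
  ... | no ℓ≢i | b rewrite ≟-neq (mark ℓ b F.≟ mark i true) (λ e → ℓ≢i (proj₁ (mark-injective e)))
                         | ≟-neq (mark ℓ b F.≟ mark i false) (λ e → ℓ≢i (proj₁ (mark-injective e))) = refl

  marked-lab : ∀ e y → E3.mem e y ≡ true → E8.lab (marked e) y ≡ mark (E3.lab e y) (mk y)
  marked-lab E3.emp y ()
  marked-lab (E3.leaf v ℓ) y m rewrite ≟-true (v F.≟ y) m = refl
  marked-lab (E3.un e f) y m rewrite marked-mem e y with E3.mem e y in me
  ... | true = marked-lab e y me
  ... | false = marked-lab f y m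
  marked-lab (E3.jn i j p e) y m = marked-lab e y m
  marked-lab (E3.rn i j e) y m rewrite marked-lab e y m = mark-rename i j (E3.lab e y) (mk y)

  joined-mark : ∀ i j b c ℓ m ℓ' m' →
    E8.joined (mark i b) (mark j c) (mark ℓ m) (mark ℓ' m') ≡
      ((⌊ ℓ F.≟ i ⌋ ∧ ⌊ m B.≟ b ⌋) ∧ (⌊ ℓ' F.≟ j ⌋ ∧ ⌊ m' B.≟ c ⌋)) ∨
      ((⌊ ℓ F.≟ j ⌋ ∧ ⌊ m B.≟ c ⌋) ∧ (⌊ ℓ' F.≟ i ⌋ ∧ ⌊ m' B.≟ b ⌋))
  joined-mark i j b c ℓ m ℓ' m'
    rewrite mark-≟ ℓ m i b | mark-≟ ℓ' m' j c | mark-≟ ℓ m j c | mark-≟ ℓ' m' i b = refl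

  four-joins : ∀ c P Q R T mx my →
    (((c ∨ (((P ∧ ⌊ mx B.≟ true ⌋) ∧ (Q ∧ ⌊ my B.≟ true ⌋)) ∨ ((R ∧ ⌊ mx B.≟ true ⌋) ∧ (T ∧ ⌊ my B.≟ true ⌋))))
        ∨ (((P ∧ ⌊ mx B.≟ true ⌋) ∧ (Q ∧ ⌊ my B.≟ false ⌋)) ∨ ((R ∧ ⌊ mx B.≟ false ⌋) ∧ (T ∧ ⌊ my B.≟ true ⌋))))
        ∨ (((P ∧ ⌊ mx B.≟ false ⌋) ∧ (Q ∧ ⌊ my B.≟ true ⌋)) ∨ ((R ∧ ⌊ mx B.≟ true ⌋) ∧ (T ∧ ⌊ my B.≟ false ⌋))))
        ∨ (((P ∧ ⌊ mx B.≟ false ⌋) ∧ (Q ∧ ⌊ my B.≟ false ⌋)) ∨ ((R ∧ ⌊ mx B.≟ false ⌋) ∧ (T ∧ ⌊ my B.≟ false ⌋)))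
    ≡ c ∨ ((P ∧ Q) ∨ (R ∧ T))
  four-joins = agree-sound 7 _ _ tt

  marked-edge : ∀ e x y → E8.edge (marked e) x y ≡ E3.edge e x y
  marked-edge E3.emp x y = refl
  marked-edge (E3.leaf v ℓ) x y = refl
  marked-edge (E3.un e f) x y rewrite marked-edge e x y | marked-edge f x y = refl
  marked-edge (E3.rn i j e) x y = marked-edge e x y
  marked-edge (E3.jn i j p e) x y rewrite marked-edge e x y | marked-mem e x | marked-mem e y
    with E3.mem e x in mx | E3.mem e y in my
  ... | false | _ rewrite E3.edge-outˡ e x y mx = refl
  ... | true | false rewrite E3.edge-outʳ e x y my = refl
  ... | true | true
    rewrite marked-lab e x mx | marked-lab e y my
          | joined-mark i j true true (E3.lab e x) (mk x) (E3.lab e y) (mk y)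
          | joined-mark i j true false (E3.lab e x) (mk x) (E3.lab e y) (mk y)
          | joined-mark i j false true (E3.lab e x) (mk x) (E3.lab e y) (mk y)
          | joined-mark i j false false (E3.lab e x) (mk x) (E3.lab e y) (mk y)
    = four-joins (E3.edge e x y) ⌊ E3.lab e x F.≟ i ⌋ ⌊ E3.lab e y F.≟ j ⌋ ⌊ E3.lab e x F.≟ j ⌋ ⌊ E3.lab e y F.≟ i ⌋ (mk x) (mk y)

  marked-wellFormed : ∀ e → E3.WellFormed e → E8.WellFormed (marked e)
  marked-wellFormed E3.emp _ = tt
  marked-wellFormed (E3.leaf _ _) _ = tt
  marked-wellFormed (E3.un e f) (we , wf , d) =
    marked-wellFormed e we , marked-wellFormed f wf , λ x m → trans (marked-mem f x) (d x (trans (sym (marked-mem e x)) m))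
  marked-wellFormed (E3.jn i j p e) w = marked-wellFormed e w
  marked-wellFormed (E3.rn i j e) w = marked-wellFormed e w

module Specs {n : ℕ} (G : Graph n) where
  open Expressions {n} {Fin 8} F._≟_ zero public
  open Adjacency G

  record Builds (e : Expr) (P : V → Bool) (Λ : V → Fin 8) : Set where
    constructor builds
    field
      wf : WellFormed e
      members : ∀ y → mem e y ≡ P y
      edges : ∀ x y → P x ≡ true → P y ≡ true → edge e x y ≡ A x y
      labels : ∀ y → P y ≡ true → lab e y ≡ Λ y
  open Builds public

  builds-emp : Builds emp (λ _ → false) (λ _ → zero)
  builds-emp = builds tt (λ y → refl) (λ { x y () _ }) (λ { y () })

  builds-leaf : ∀ v ℓ → Builds (leaf v ℓ) (eqV v) (λ _ → ℓ)
  builds-leaf v ℓ = builds tt (λ y → refl)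
    (λ x y mx my → trans (sym (irrefl G x)) (cong (A x) (trans (sym (≟-true (v F.≟ x) mx)) (≟-true (v F.≟ y) my))))
    (λ _ _ → refl)

  builds-rn : ∀ {e P Λ} i j → Builds e P Λ → Builds (rn i j e) P (λ y → if eqL (Λ y) i then j else Λ y)
  builds-rn i j (builds w m ok lb) = builds w m ok λ y py → cong (λ l → if eqL l i then j else l) (lb y py)

  builds-relabel : ∀ {e P Λ} Λ' → Builds e P Λ → (∀ y → P y ≡ true → Λ y ≡ Λ' y) → Builds e P Λ'
  builds-relabel Λ' (builds w m ok lb) h = builds w m ok λ y py → trans (lb y py) (h y py)

  builds-on : ∀ {e P Λ} P' → Builds e P Λ → (∀ y → P y ≡ P' y) → Builds e P' Λ
  builds-on P' (builds w m ok lb) h = builds w (λ y → trans (m y) (h y))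
    (λ x y px py → ok x y (trans (h x) px) (trans (h y) py)) (λ y py → lb y (trans (h y) py))

  module Union {e f P Q Λ μ} (be : Builds e P Λ) (bf : Builds f Q μ)
               (disjoint : ∀ a → P a ≡ true → Q a ≡ false) where
    u = un e f

    data Side (a : V) : Set where
      inP : mem e a ≡ true → mem f a ≡ false → P a ≡ true → Side a
      inQ : mem e a ≡ false → mem f a ≡ true → Q a ≡ true → Side a

    side : ∀ a → P a ∨ Q a ≡ true → Side a
    side a h with P a in pa
    ... | true = inP (trans (members be a) pa) (trans (members bf a) (disjoint a pa)) pa
    ... | false = inQ (trans (members be a) pa) (trans (members bf a) h) h

    mem-u : ∀ {a} → Side a → mem u a ≡ true
    mem-u (inP m _ _) = ∨-inl m
    mem-u (inQ m₁ m₂ _) rewrite m₁ = m₂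

    lab-u : ∀ {a} → Side a → lab u a ≡ (if P a then Λ a else μ a)
    lab-u {a} (inP m _ pa) rewrite m | pa = labels be a pa
    lab-u {a} (inQ m _ qa) rewrite m | trans (sym (members be a)) m = labels bf a qa

    wf-u : WellFormed u
    wf-u = wf be , wf bf , (λ x m → trans (members bf x) (disjoint x (trans (sym (members be x)) m)))

    members-u : ∀ y → mem u y ≡ P y ∨ Q y
    members-u y = cong₂ _∨_ (members be y) (members bf y)

    plain-union : (∀ a b → P a ≡ true → Q b ≡ true → A a b ≡ false) →
                  Builds u (λ y → P y ∨ Q y) (λ y → if P y then Λ y else μ y)
    plain-union across = builds wf-u members-u edges-u (λ y h → lab-u (side y h))
      where
      edges-u : ∀ a b → P a ∨ Q a ≡ true → P b ∨ Q b ≡ true → edge u a b ≡ A a b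
      edges-u a b ha hb with side a ha | side b hb
      ... | inP ma fa pa | inP mb fb pb rewrite edge-outˡ f a b fa = trans (∨-identityʳ _) (edges be a b pa pb)
      ... | inQ ma fa qa | inQ mb fb qb rewrite edge-outˡ e a b ma = edges bf a b qa qb
      ... | inP ma fa pa | inQ mb fb qb rewrite edge-outʳ e a b mb | edge-outˡ f a b fa = sym (across a b pa qb)
      ... | inQ ma fa qa | inP mb fb pb rewrite edge-outˡ e a b ma | edge-outʳ f a b fb =
        sym (trans (adj-sym G a b) (across b a pb qa))

    join-union : (i j : Fin 8) (i≢j : i ≢ j) →
                 (∀ a b → P a ≡ true → Q b ≡ true → A a b ≡ joined i j (Λ a) (μ b)) →
                 (∀ a b → P a ≡ true → P b ≡ true → joined i j (Λ a) (Λ b) ≡ false) →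
                 (∀ a b → Q a ≡ true → Q b ≡ true → joined i j (μ a) (μ b) ≡ false) →
                 Builds (jn i j i≢j u) (λ y → P y ∨ Q y) (λ y → if P y then Λ y else μ y)
    join-union i j i≢j across not-in-P not-in-Q = builds wf-u members-u edges-u (λ y h → lab-u (side y h))
      where
      edges-u : ∀ a b → P a ∨ Q a ≡ true → P b ∨ Q b ≡ true → edge (jn i j i≢j u) a b ≡ A a b
      edges-u a b ha hb with side a ha | side b hb
      ... | inP ma fa pa | inP mb fb pb
        rewrite mem-u (inP ma fa pa) | mem-u (inP mb fb pb) | labels be a pa | labels be b pb | ma | mb | pa | pb
              | not-in-P a b pa pb | edge-outˡ f a b fa | edges be a b pa pb = trans (∨-identityʳ _) (∨-identityʳ _)
      ... | inQ ma fa qa | inQ mb fb qb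
        rewrite mem-u (inQ ma fa qa) | mem-u (inQ mb fb qb) | ma | mb | trans (sym (members be a)) ma
              | trans (sym (members be b)) mb | labels bf a qa | labels bf b qb | not-in-Q a b qa qb
              | edge-outˡ e a b ma | edges bf a b qa qb = ∨-identityʳ _
      ... | inP ma fa pa | inQ mb fb qb
        rewrite mem-u (inP ma fa pa) | mem-u (inQ mb fb qb) | ma | mb | pa | trans (sym (members be b)) mb
              | labels be a pa | labels bf b qb | edge-outʳ e a b mb | edge-outˡ f a b fa = sym (across a b pa qb)
      ... | inQ ma fa qa | inP mb fb pb
        rewrite mem-u (inQ ma fa qa) | mem-u (inP mb fb pb) | ma | mb | pb | trans (sym (members be a)) ma
              | labels be b pb | labels bf a qa | edge-outˡ e a b ma | edge-outʳ f a b fb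
        = sym (trans (adj-sym G a b) (trans (across b a pb qa) (joined-sym i j (Λ b) (μ a))))

module Connectivity {n : ℕ} (S : Fin n → Bool) (G : Graph n) where
  conn-trans : ∀ {u v w} → ConnOn S G u v → ConnOn S G v w → ConnOn S G u w
  conn-trans c (here _) = c
  conn-trans c (step d s a) = step (conn-trans c d) s a

  conn-end : ∀ {u v} → ConnOn S G u v → S v ≡ true
  conn-end (here s) = s
  conn-end (step _ s _) = s

  conn-sym : ∀ {u v} → ConnOn S G u v → ConnOn S G v u
  conn-sym (here s) = here s
  conn-sym (step {v = v'} {w = w} c s a) = conn-trans (step (here s) (conn-end c) (trans (adj-sym G w v') a)) (conn-sym c)

-- V2 = complement V1 is covered by separated pieces.  Each piece P is
-- anchored at the unique x ∈ V1 adjacent to it (unique because P is connected and its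
-- component has at most one neighbour in V1) or is free.  With labels
--   D (dead), M (marked, i.e. adjacent to the anchor), X (current vertex of V1),
--   Cl (vertices of V1 already placed),
-- part x joins x to the marked vertices of the pieces anchored at x, and the parts of
-- x₁, x₂, … are added one at a time by a join Cl–X (making V1 a clique) followed by the
-- renaming X → Cl.  Finally the free pieces are added by a plain union.

D M X Cl : Fin 8
D = mark zero false
M = mark zero true
X = suc (suc (suc (suc (suc (suc zero)))))
Cl = suc (suc (suc (suc (suc (suc (suc zero))))))

marked-or-dead : Bool → Fin 8
marked-or-dead b = if b then M else D

collapse-label : Fin 8 → Fin 8
collapse-label l₀ =
  let l₁ = if ⌊ l₀ F.≟ mark (suc zero) false ⌋ then D else l₀
      l₂ = if ⌊ l₁ F.≟ mark (suc (suc zero)) false ⌋ then D else l₁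
      l₃ = if ⌊ l₂ F.≟ mark (suc zero) true ⌋ then M else l₂
  in if ⌊ l₃ F.≟ mark (suc (suc zero)) true ⌋ then M else l₃

collapse-mark : ∀ ℓ m → collapse-label (mark ℓ m) ≡ marked-or-dead m
collapse-mark zero false = refl
collapse-mark zero true = refl
collapse-mark (suc zero) false = refl
collapse-mark (suc zero) true = refl
collapse-mark (suc (suc zero)) false = refl
collapse-mark (suc (suc zero)) true = refl

module Assembly {n : ℕ} (G : Graph n) (V1 : Fin n → Bool)
    (clique : ∀ u v → V1 u ≡ true → V1 v ≡ true → u ≢ v → adj G u v ≡ true)
    (diamondFree : FreeOn (complement V1) G diamondAdj)
    (chordal : ChordalOn (complement V1) G)
    (one-neighbour : ∀ u v x y → ConnOn (complement V1) G u v → V1 x ≡ true → V1 y ≡ true →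
                     adj G x u ≡ true → adj G y v ≡ true → x ≡ y) where
  S : Fin n → Bool
  S = complement V1

  open Adjacency G
  open VertexLists {n}
  open Pieces G S diamondFree chordal
  open Connectivity S G
  module Three = PruningSteps G
  module Eight = Specs G
  open Eight using (Builds; builds; members; edges; labels; module Union)

  V1⇒not-S : ∀ {y} → V1 y ≡ true → S y ≡ false
  V1⇒not-S h rewrite h = refl

  S⇒not-V1 : ∀ {y} → S y ≡ true → V1 y ≡ false
  S⇒not-V1 {y} h with V1 y
  ... | false = refl
  ... | true = ⊥-elim (true≢false h refl)

  V2-list : List V
  V2-list = keep S (allVertices n)

  V2-list-in-S : ∀ y → elem y V2-list ≡ true → S y ≡ true
  V2-list-in-S y m = proj₂ (elem-keep⁻ S (allVertices n) y m)

  pieces : Cover V2-list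
  pieces = cover (length V2-list) V2-list ℕP.≤-refl V2-list-in-S

  Ps : List Piece
  Ps = proj₁ pieces
  separated : Separated Ps
  separated = proj₁ (proj₂ pieces)
  inPieces≡S : ∀ y → inPieces Ps y ≡ S y
  inPieces≡S y = bool-⇔ (λ m → V2-list-in-S y (trans (sym (proj₂ (proj₂ pieces) y)) m))
                        (λ s → trans (proj₂ (proj₂ pieces) y) (elem-keep⁺ S (allVertices n) y (allVertices-complete n y) s))

  inP : Piece → V → Bool
  inP P = Three.mem (expr P)

  data Anchor (P : Piece) : Set where
    at   : ∀ x → V1 x ≡ true → (∀ a y → V1 a ≡ true → inP P y ≡ true → A a y ≡ true → a ≡ x) → Anchor P
    free : (∀ a y → V1 a ≡ true → inP P y ≡ true → A a y ≡ false) → Anchor P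

  anchor : ∀ P → Anchor P
  anchor P with FP.any? (λ a → (V1 a B.≟ true) ×-dec FP.any? (λ y → (inP P y ∧ A a y) B.≟ true))
  ... | yes (x , x∈V1 , y₀ , h) = at x x∈V1 unique
    where
    unique : ∀ a y → V1 a ≡ true → inP P y ≡ true → A a y ≡ true → a ≡ x
    unique a y a∈V1 y∈P a~y =
      sym (one-neighbour y₀ y x a (conn-trans (conn-sym (connected P y₀ (∧-conicalˡ _ _ h))) (connected P y y∈P))
                         x∈V1 a∈V1 (∧-conicalʳ (inP P y₀) _ h) a~y)
  ... | no none = free no-edge
    where
    no-edge : ∀ a y → V1 a ≡ true → inP P y ≡ true → A a y ≡ false
    no-edge a y a∈V1 y∈P with A a y in a~y
    ... | false = refl
    ... | true = ⊥-elim (none (a , a∈V1 , y , trans (cong (_∧ A a y) y∈P) a~y))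

  anchored-at : V → Piece → Bool
  anchored-at x P with anchor P
  ... | at x' _ _ = eqV x x'
  ... | free _ = false

  anchored-in : List V → Piece → Bool
  anchored-in xs P with anchor P
  ... | at x' _ _ = elem x' xs
  ... | free _ = false

  unanchored : Piece → Bool
  unanchored P with anchor P
  ... | at _ _ _ = false
  ... | free _ = true

  anchored-at-only : ∀ x P → anchored-at x P ≡ true → ∀ a y → V1 a ≡ true → inP P y ≡ true → A a y ≡ true → a ≡ x
  anchored-at-only x P h a y va my ay with anchor P
  ... | at x' _ only = trans (only a y va my ay) (sym (≟-true (x F.≟ x') h))
  anchored-at-only x P () a y va my ay | free _

  anchored-in-only : ∀ xs P → anchored-in xs P ≡ true → ∀ a y → V1 a ≡ true → inP P y ≡ true → A a y ≡ true →
                     elem a xs ≡ true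
  anchored-in-only xs P h a y va my ay with anchor P
  ... | at x' _ only rewrite only a y va my ay = h
  anchored-in-only xs P () a y va my ay | free _

  unanchored-none : ∀ P → unanchored P ≡ true → ∀ a y → V1 a ≡ true → inP P y ≡ true → A a y ≡ false
  unanchored-none P h a y va my with anchor P
  ... | free none = none a y va my
  unanchored-none P () a y va my | at _ _ _

  anchored-in-at : ∀ xs x P → anchored-in xs P ≡ true → anchored-at x P ≡ true → elem x xs ≡ true
  anchored-in-at xs x P h₁ h₂ with anchor P
  ... | at x' _ _ rewrite ≟-true (x F.≟ x') h₂ = h₁
  anchored-in-at xs x P () h₂ | free _

  anchored-in-cons : ∀ x xs P → anchored-in (x ∷ xs) P ≡ anchored-at x P ∨ anchored-in xs P
  anchored-in-cons x xs P with anchor P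
  ... | at x' _ _ = refl
  ... | free _ = refl

  anchored-in-nil : ∀ P → anchored-in [] P ≡ false
  anchored-in-nil P with anchor P
  ... | at _ _ _ = refl
  ... | free _ = refl

  anchored-or-free : ∀ xs → (∀ x → V1 x ≡ true → elem x xs ≡ true) → ∀ P → anchored-in xs P ∨ unanchored P ≡ true
  anchored-or-free xs all P with anchor P
  ... | at x x∈V1 _ = ∨-inl (all x x∈V1)
  ... | free _ = refl

  inSelected : (Piece → Bool) → List Piece → V → Bool
  inSelected s [] y = false
  inSelected s (P ∷ Qs) y = (s P ∧ inP P y) ∨ inSelected s Qs y

  selected-piece : ∀ s Qs y → inSelected s Qs y ≡ true → Σ Piece λ P → s P ≡ true × inP P y ≡ true
  selected-piece s [] y ()
  selected-piece s (P ∷ Qs) y h with ∨-cases (s P ∧ inP P y) h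
  ... | inj₁ q = P , ∧-conicalˡ _ _ q , ∧-conicalʳ (s P) _ q
  ... | inj₂ q = selected-piece s Qs y q

  selected⊆pieces : ∀ s Qs y → inSelected s Qs y ≡ true → inPieces Qs y ≡ true
  selected⊆pieces s [] y ()
  selected⊆pieces s (P ∷ Qs) y h with ∨-cases (s P ∧ inP P y) h
  ... | inj₁ q = ∨-inl (∧-conicalʳ (s P) _ q)
  ... | inj₂ q = ∨-inr (inP P y) (selected⊆pieces s Qs y q)

  selected⇒S : ∀ s y → inSelected s Ps y ≡ true → S y ≡ true
  selected⇒S s y h = trans (sym (inPieces≡S y)) (selected⊆pieces s Ps y h)

  selected-not-V1 : ∀ s y → V1 y ≡ true → inSelected s Ps y ≡ false
  selected-not-V1 s y vy with inSelected s Ps y in e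
  ... | false = refl
  ... | true = ⊥-elim (true≢false (selected⇒S s y e) (V1⇒not-S vy))

  Exclusive : (Piece → Bool) → (Piece → Bool) → Set
  Exclusive s₁ s₂ = ∀ P → s₁ P ≡ true → s₂ P ≡ true → ⊥

  exclusive-nonadjacent : ∀ Qs → Separated Qs → ∀ s₁ s₂ → Exclusive s₁ s₂ → ∀ a b →
                          inSelected s₁ Qs a ≡ true → inSelected s₂ Qs b ≡ true → A a b ≡ false
  exclusive-nonadjacent [] _ s₁ s₂ ex a b () _
  exclusive-nonadjacent (P ∷ Qs) (sep , disj , nonadj) s₁ s₂ ex a b ha hb
    with ∨-cases (s₁ P ∧ inP P a) ha | ∨-cases (s₂ P ∧ inP P b) hb
  ... | inj₁ p | inj₁ q = ⊥-elim (ex P (∧-conicalˡ _ _ p) (∧-conicalˡ _ _ q))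
  ... | inj₁ p | inj₂ q = nonadj a b (∧-conicalʳ (s₁ P) _ p) (selected⊆pieces s₂ Qs b q)
  ... | inj₂ p | inj₁ q = trans (adj-sym G a b) (nonadj b a (∧-conicalʳ (s₂ P) _ q) (selected⊆pieces s₁ Qs a p))
  ... | inj₂ p | inj₂ q = exclusive-nonadjacent Qs sep s₁ s₂ ex a b p q

  exclusive-disjoint : ∀ Qs → Separated Qs → ∀ s₁ s₂ → Exclusive s₁ s₂ → ∀ a →
                       inSelected s₁ Qs a ≡ true → inSelected s₂ Qs a ≡ false
  exclusive-disjoint [] _ s₁ s₂ ex a ()
  exclusive-disjoint (P ∷ Qs) (sep , disj , nonadj) s₁ s₂ ex a ha with ∨-cases (s₁ P ∧ inP P a) ha
  ... | inj₁ p with s₂ P in s₂P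
  ...   | true = ⊥-elim (ex P (∧-conicalˡ _ _ p) s₂P)
  ...   | false with inSelected s₂ Qs a in r
  ...     | false = refl
  ...     | true = ⊥-elim (true≢false (selected⊆pieces s₂ Qs a r) (disj a (∧-conicalʳ (s₁ P) _ p)))
  exclusive-disjoint (P ∷ Qs) (sep , disj , nonadj) s₁ s₂ ex a ha | inj₂ p
    rewrite exclusive-disjoint Qs sep s₁ s₂ ex a p with inP P a in mP
  ... | false = trans (∨-identityʳ _) (∧-zeroʳ (s₂ P))
  ... | true = ⊥-elim (true≢false (selected⊆pieces s₁ Qs a p) (disj a mP))

  inSelected-cons : ∀ x xs Qs y →
                    inSelected (anchored-in (x ∷ xs)) Qs y ≡ inSelected (anchored-at x) Qs y ∨ inSelected (anchored-in xs) Qs y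
  inSelected-cons x xs [] y = refl
  inSelected-cons x xs (P ∷ Qs) y rewrite anchored-in-cons x xs P | inSelected-cons x xs Qs y =
    agree-sound 5 (λ a b m r₁ r₂ → ((a ∨ b) ∧ m) ∨ (r₁ ∨ r₂)) (λ a b m r₁ r₂ → ((a ∧ m) ∨ r₁) ∨ ((b ∧ m) ∨ r₂)) tt
      (anchored-at x P) (anchored-in xs P) (inP P y) (inSelected (anchored-at x) Qs y) (inSelected (anchored-in xs) Qs y)

  inSelected-nil : ∀ Qs y → inSelected (anchored-in []) Qs y ≡ false
  inSelected-nil [] y = refl
  inSelected-nil (P ∷ Qs) y rewrite inSelected-nil Qs y | anchored-in-nil P = refl

  collapse : Eight.Expr → Eight.Expr
  collapse e = Eight.rn (mark (suc (suc zero)) true) M (Eight.rn (mark (suc zero) true) M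
                 (Eight.rn (mark (suc (suc zero)) false) D (Eight.rn (mark (suc zero) false) D e)))

  pieceExpr : Piece → (V → Bool) → Eight.Expr
  pieceExpr P mk = collapse (Marking.marked mk (expr P))

  builds-piece : ∀ P mk → Builds (pieceExpr P mk) (inP P) (λ y → marked-or-dead (mk y))
  builds-piece P mk =
    Eight.builds-relabel (λ y → marked-or-dead (mk y))
      (Eight.builds-rn (mark (suc (suc zero)) true) M (Eight.builds-rn (mark (suc zero) true) M
        (Eight.builds-rn (mark (suc (suc zero)) false) D (Eight.builds-rn (mark (suc zero) false) D marked-spec))))
      (λ y _ → collapse-mark (Three.lab (expr P) y) (mk y))
    where
    module Mk = Marking mk
    gen = generates P
    marked-spec : Builds (Mk.marked (expr P)) (inP P) (λ y → mark (Three.lab (expr P) y) (mk y))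
    marked-spec = builds (Mk.marked-wellFormed (expr P) (proj₁ gen)) (Mk.marked-mem (expr P))
                    (λ x y px py → trans (Mk.marked-edge (expr P) x y) (proj₂ (proj₂ gen) x y px py))
                    (λ y py → Mk.marked-lab (expr P) y py)

  selection : (Piece → Bool) → (V → Bool) → List Piece → Eight.Expr
  selection s mk [] = Eight.emp
  selection s mk (P ∷ Qs) = if s P then Eight.un (pieceExpr P mk) (selection s mk Qs) else selection s mk Qs

  builds-selection : ∀ s mk Qs → Separated Qs → Builds (selection s mk Qs) (inSelected s Qs) (λ y → marked-or-dead (mk y))
  builds-selection s mk [] _ = Eight.builds-relabel (λ y → marked-or-dead (mk y)) Eight.builds-emp (λ y ())
  builds-selection s mk (P ∷ Qs) (sep , disj , nonadj) with s P
  ... | false = builds-selection s mk Qs sep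
  ... | true = Eight.builds-relabel (λ y → marked-or-dead (mk y))
                 (Union.plain-union (builds-piece P mk) (builds-selection s mk Qs sep) disj' nonadj')
                 (λ y _ → same-branches (inP P y) (marked-or-dead (mk y)))
    where
    same-branches : ∀ b (c : Fin 8) → (if b then c else c) ≡ c
    same-branches true _ = refl
    same-branches false _ = refl
    disj' : ∀ a → inP P a ≡ true → inSelected s Qs a ≡ false
    disj' a m with inSelected s Qs a in r
    ... | false = refl
    ... | true = ⊥-elim (true≢false (selected⊆pieces s Qs a r) (disj a m))
    nonadj' : ∀ a b → inP P a ≡ true → inSelected s Qs b ≡ true → A a b ≡ false
    nonadj' a b ma mb = nonadj a b ma (selected⊆pieces s Qs b mb)

  X≢M : X ≢ M
  X≢M ()

  part : V → Eight.Expr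
  part x = Eight.rn M D (Eight.jn X M X≢M (Eight.un (Eight.leaf x X) (selection (anchored-at x) (A x) Ps)))

  inPart : V → V → Bool
  inPart x y = eqV x y ∨ inSelected (anchored-at x) Ps y

  builds-part : ∀ x → V1 x ≡ true → Builds (part x) (inPart x) (λ y → if eqV x y then X else D)
  builds-part x x∈V1 =
    Eight.builds-relabel _ (Eight.builds-rn M D joined-x) (λ y _ → kill-marks (eqV x y) (A x y))
    where
    disj : ∀ a → eqV x a ≡ true → inSelected (anchored-at x) Ps a ≡ false
    disj a h with ≟-true (x F.≟ a) h
    ... | refl = selected-not-V1 (anchored-at x) x x∈V1
    x-sees-marked : ∀ c → Eight.joined X M X (marked-or-dead c) ≡ c
    x-sees-marked false = refl
    x-sees-marked true = refl
    across : ∀ a b → eqV x a ≡ true → inSelected (anchored-at x) Ps b ≡ true →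
             A a b ≡ Eight.joined X M X (marked-or-dead (A x b))
    across a b h _ with ≟-true (x F.≟ a) h
    ... | refl = sym (x-sees-marked (A x b))
    no-X : ∀ b c → Eight.joined X M (marked-or-dead b) (marked-or-dead c) ≡ false
    no-X false false = refl
    no-X false true = refl
    no-X true false = refl
    no-X true true = refl
    joined-x = Union.join-union (Eight.builds-leaf x X) (builds-selection (anchored-at x) (A x) Ps separated) disj
                 X M X≢M across (λ _ _ _ _ → refl) (λ a b _ _ → no-X (A x a) (A x b))
    kill-marks : ∀ e c → (let l = if e then X else marked-or-dead c in if Eight.eqL l M then D else l) ≡ (if e then X else D)
    kill-marks false false = refl
    kill-marks false true = refl
    kill-marks true false = refl
    kill-marks true true = refl

  Cl≢X : Cl ≢ X
  Cl≢X ()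

  parts : List V → Eight.Expr
  parts [] = Eight.emp
  parts (x ∷ xs) = Eight.rn X Cl (Eight.jn Cl X Cl≢X (Eight.un (parts xs) (part x)))

  inParts : List V → V → Bool
  inParts xs y = (V1 y ∧ elem y xs) ∨ inSelected (anchored-in xs) Ps y

  partsLabel : V → Fin 8
  partsLabel y = if V1 y then Cl else D

  data PartsSide (xs : List V) (a : V) : Set where
    clique-side : V1 a ≡ true → elem a xs ≡ true → PartsSide xs a
    piece-side  : V1 a ≡ false → inSelected (anchored-in xs) Ps a ≡ true → PartsSide xs a

  parts-side : ∀ xs a → inParts xs a ≡ true → PartsSide xs a
  parts-side xs a h with ∨-cases (V1 a ∧ elem a xs) h
  ... | inj₁ q = clique-side (∧-conicalˡ _ _ q) (∧-conicalʳ (V1 a) _ q)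
  ... | inj₂ q = piece-side (S⇒not-V1 (selected⇒S (anchored-in xs) a q)) q

  module AddPart (x : V) (xs : List V) (x∈V1 : V1 x ≡ true) (x∉xs : elem x xs ≡ false)
                 (previous : Builds (parts xs) (inParts xs) partsLabel) where
    not-x : ∀ a → elem a xs ≡ true → a ≢ x
    not-x a m refl = true≢false m x∉xs

    exclusive : Exclusive (anchored-in xs) (anchored-at x)
    exclusive P h₁ h₂ = true≢false (anchored-in-at xs x P h₁ h₂) x∉xs

    disjoint : ∀ a → inParts xs a ≡ true → inPart x a ≡ false
    disjoint a h with parts-side xs a h
    ... | clique-side va ea = ∨-false (≟-neq (x F.≟ a) (λ q → not-x a ea (sym q))) (selected-not-V1 (anchored-at x) a va)
    ... | piece-side va ma = ∨-false (≟-neq (x F.≟ a) (λ { refl → true≢false x∈V1 va }))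
                                     (exclusive-disjoint Ps separated (anchored-in xs) (anchored-at x) exclusive a ma)

    across : ∀ a b → inParts xs a ≡ true → inPart x b ≡ true →
             A a b ≡ Eight.joined Cl X (partsLabel a) (if eqV x b then X else D)
    across a b ha hb with parts-side xs a ha | eqV x b in xb
    ... | clique-side va ea | true rewrite va | sym (≟-true (x F.≟ b) xb) = clique a x va x∈V1 (not-x a ea)
    ... | clique-side va ea | false rewrite va with A a b in ab
    ...   | false = refl
    ...   | true with selected-piece (anchored-at x) Ps b hb
    ...     | P , sP , mP = ⊥-elim (not-x a ea (anchored-at-only x P sP a b va mP ab))
    across a b ha hb | piece-side va ma | true rewrite va | sym (≟-true (x F.≟ b) xb) with A x a in xa
    ... | false = trans (adj-sym G a x) xa
    ... | true with selected-piece (anchored-in xs) Ps a ma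
    ...   | P , sP , mP = ⊥-elim (true≢false (anchored-in-only xs P sP x a x∈V1 mP xa) x∉xs)
    across a b ha hb | piece-side va ma | false rewrite va =
      exclusive-nonadjacent Ps separated (anchored-in xs) (anchored-at x) exclusive a b ma hb

    no-X-before : ∀ b c → Eight.joined Cl X (if b then Cl else D) (if c then Cl else D) ≡ false
    no-X-before false false = refl
    no-X-before false true = refl
    no-X-before true false = refl
    no-X-before true true = refl

    no-Cl-in-part : ∀ b c → Eight.joined Cl X (if b then X else D) (if c then X else D) ≡ false
    no-Cl-in-part false false = refl
    no-Cl-in-part false true = refl
    no-Cl-in-part true false = refl
    no-Cl-in-part true true = refl

    joined-parts = Union.join-union previous (builds-part x x∈V1) disjoint Cl X Cl≢X across
                     (λ a b _ _ → no-X-before (V1 a) (V1 b)) (λ a b _ _ → no-Cl-in-part (eqV x a) (eqV x b))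

    relabelled : ∀ y → inParts xs y ∨ inPart x y ≡ true →
                 (let l = if inParts xs y then partsLabel y else (if eqV x y then X else D)
                  in if Eight.eqL l X then Cl else l) ≡ partsLabel y
    relabelled y h with inParts xs y in py
    ... | true with V1 y
    ...   | true = refl
    ...   | false = refl
    relabelled y h | false with eqV x y in xy
    ... | true rewrite sym (≟-true (x F.≟ y) xy) | x∈V1 = refl
    ... | false rewrite S⇒not-V1 (selected⇒S (anchored-at x) y h) = refl

    members-cons : ∀ y → inParts xs y ∨ inPart x y ≡ inParts (x ∷ xs) y
    members-cons y rewrite inSelected-cons x xs Ps y with eqV x y in xy
    ... | false = agree-sound 4 (λ a l sX sI → ((a ∧ l) ∨ sI) ∨ (false ∨ sX))
                                (λ a l sX sI → (a ∧ (false ∨ l)) ∨ (sX ∨ sI)) tt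
                    (V1 y) (elem y xs) (inSelected (anchored-at x) Ps y) (inSelected (anchored-in xs) Ps y)
    ... | true rewrite sym (≟-true (x F.≟ y) xy) | x∈V1 =
      agree-sound 3 (λ l sX sI → ((true ∧ l) ∨ sI) ∨ (true ∨ sX)) (λ l sX sI → (true ∧ (true ∨ l)) ∨ (sX ∨ sI)) tt
        (elem x xs) (inSelected (anchored-at x) Ps x) (inSelected (anchored-in xs) Ps x)

    result : Builds (parts (x ∷ xs)) (inParts (x ∷ xs)) partsLabel
    result = Eight.builds-on (inParts (x ∷ xs)) (Eight.builds-relabel partsLabel (Eight.builds-rn X Cl joined-parts) relabelled)
               members-cons

  builds-parts : ∀ xs → (∀ x → elem x xs ≡ true → V1 x ≡ true) → NoDup xs → Builds (parts xs) (inParts xs) partsLabel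
  builds-parts [] _ _ = Eight.builds-on (inParts []) (Eight.builds-relabel partsLabel Eight.builds-emp (λ y ()))
                          (λ y → sym (trans (cong (_∨ inSelected (anchored-in []) Ps y) (∧-zeroʳ (V1 y))) (inSelected-nil Ps y)))
  builds-parts (x ∷ xs) inV1 (x∉xs , nodup) =
    AddPart.result x xs (inV1 x (∨-inl (eqV-refl x))) x∉xs (builds-parts xs (λ y m → inV1 y (∨-inr (eqV x y) m)) nodup)

  V1-list : List V
  V1-list = keep V1 (allVertices n)

  V1-list-sound : ∀ x → elem x V1-list ≡ true → V1 x ≡ true
  V1-list-sound x m = proj₂ (elem-keep⁻ V1 (allVertices n) x m)

  V1-list-complete : ∀ x → V1 x ≡ true → elem x V1-list ≡ true
  V1-list-complete x v = elem-keep⁺ V1 (allVertices n) x (allVertices-complete n x) v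

  whole : Eight.Expr
  whole = Eight.un (parts V1-list) (selection unanchored (λ _ → false) Ps)

  inWhole : V → Bool
  inWhole y = inParts V1-list y ∨ inSelected unanchored Ps y

  builds-whole : Builds whole inWhole (λ y → if inParts V1-list y then partsLabel y else D)
  builds-whole = Union.plain-union (builds-parts V1-list V1-list-sound (keep-NoDup V1 (allVertices n) (allVertices-NoDup n)))
                                   (builds-selection unanchored (λ _ → false) Ps separated) disjoint across
    where
    exclusive : Exclusive (anchored-in V1-list) unanchored
    exclusive P h₁ h₂ with anchor P
    exclusive P h₁ () | at _ _ _
    exclusive P () h₂ | free _
    disjoint : ∀ a → inParts V1-list a ≡ true → inSelected unanchored Ps a ≡ false
    disjoint a h with parts-side V1-list a h
    ... | clique-side va _ = selected-not-V1 unanchored a va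
    ... | piece-side _ ma = exclusive-disjoint Ps separated (anchored-in V1-list) unanchored exclusive a ma
    across : ∀ a b → inParts V1-list a ≡ true → inSelected unanchored Ps b ≡ true → A a b ≡ false
    across a b ha hb with parts-side V1-list a ha
    ... | clique-side va _ with selected-piece unanchored Ps b hb
    ...   | P , sP , mP = unanchored-none P sP a b va mP
    across a b ha hb | piece-side _ ma = exclusive-nonadjacent Ps separated (anchored-in V1-list) unanchored exclusive a b ma hb

  selected-by-either : ∀ Qs y → inPieces Qs y ≡ true → ∀ s₁ s₂ → (∀ P → s₁ P ∨ s₂ P ≡ true) →
                       inSelected s₁ Qs y ∨ inSelected s₂ Qs y ≡ true
  selected-by-either [] y () s₁ s₂ covers
  selected-by-either (P ∷ Qs) y h s₁ s₂ covers with ∨-cases (inP P y) h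
  ... | inj₂ q with ∨-cases (inSelected s₁ Qs y) (selected-by-either Qs y q s₁ s₂ covers)
  ...   | inj₁ r = ∨-inl (∨-inr (s₁ P ∧ inP P y) r)
  ...   | inj₂ r = ∨-inr (inSelected s₁ (P ∷ Qs) y) (∨-inr (s₂ P ∧ inP P y) r)
  selected-by-either (P ∷ Qs) y h s₁ s₂ covers | inj₁ q with ∨-cases (s₁ P) (covers P)
  ... | inj₁ s = ∨-inl (∨-inl (subst (λ b → b ∧ inP P y ≡ true) (sym s) q))
  ... | inj₂ s = ∨-inr (inSelected s₁ (P ∷ Qs) y) (∨-inl (subst (λ b → b ∧ inP P y ≡ true) (sym s) q))

  everything : ∀ y → inWhole y ≡ true
  everything y with V1 y in vy
  ... | true = ∨-inl (∨-inl (V1-list-complete y vy))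
  ... | false with ∨-cases (inSelected (anchored-in V1-list) Ps y)
                           (selected-by-either Ps y (trans (inPieces≡S y) (cong not vy)) (anchored-in V1-list) unanchored
                                               (anchored-or-free V1-list V1-list-complete))
  ...   | inj₁ r = ∨-inl r
  ...   | inj₂ r = ∨-inr (inSelected (anchored-in V1-list) Ps y) r

  clique-width≤8 : CliqueWidthAtMost 8 G
  clique-width≤8 = Realisation.realise zero G whole (Builds.wf builds-whole)
                     (λ y → trans (members builds-whole y) (everything y))
                     (λ x y → edges builds-whole x y (everything x) (everything y))


lemma25 : Σ ℕ λ c → (n : ℕ) (G : Graph n) → QuasiDiamondFree G → CliqueWidthAtMost c G
lemma25 = 8 , λ n G → λ { (V1 , clique , diamondFree , chordal , one-neighbour) →
                          Assembly.clique-width≤8 G V1 clique diamondFree chordal one-neighbour }
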